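{- Let $G_1$ be a graph cellularly embedded in a closed surface (orientable or not), with edge set $E$. Let $\mathcal{V}_1,\mathcal{V}_2,\mathcal{V}_3\subseteq 2^E$ be the subspaces over $GF(2)$ spanned respectively by the vertex coboundaries of $G_1$, by the face boundaries of $G_1$, and by the zigzag paths of $G_1$. For each permutation $(i,j,k)$ of $(1,2,3)$ define the cycle deficiency $\mathrm{cdef}(G_i)=\dim\big(\mathcal{V}_i^\perp/(\mathcal{V}_j+\mathcal{V}_k)\big)$. Then $\mathrm{cdef}(G_1)=\mathrm{cdef}(G_2)=\mathrm{cdef}(G_3)$.
   Context: $2^E$ is the vector space over $GF(2)$ of subsets of $E$ with symmetric difference as sum. Two subsets $A,B\subseteq E$ are orthogonal if $|A\cap B|$ is even, and $W^\perp=\{u\in 2^E: |u\cap w| \text{ even for all } w\in W\}$. The coboundary of a vertex is the set of non-loop edges incident to it. A face boundary, or a zigzag path, is regarded as the element of $2^E$ consisting of the edges it traverses an odd number of times. A zigzag path (Petrie walk) of an embedded graph is a closed walk that, at successive vertices, alternately leaves along the edge immediately to the left and immediately to the right (in the local rotation of the surface) of the edge by which it arrived; every edge is traversed exactly twice in total by the zigzag paths. $G_2$ denotes the surface dual of $G_1$ (vertices = faces of $G_1$, edge set $E$), and $G_3$ (the phial of $G_1$) denotes the graph with edge set $E$ whose vertices are the zigzag paths of $G_1$, each edge joining the zigzag paths traversing it; thus $\mathcal{V}_i$ is the coboundary space of $G_i$, and $\mathcal{V}_j+\mathcal{V}_k\subseteq\mathcal{V}_i^\perp$. -}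

module Defs where

open import Data.Bool using (Bool; true; false; _∧_; _∨_; not; _xor_)
open import Data.Nat using (ℕ; zero; suc; _∸_; _/_; _%_; _≡ᵇ_)
open import Data.Nat.Logarithm using (⌊log₂_⌋)
open import Data.Fin using (Fin)
open import Data.Fin.Properties as FinP using ()
open import Data.Fin.Subset using (Subset; _∩_; ∣_∣)
open import Data.Vec as Vec using (Vec; []; _∷_; zipWith; tabulate; replicate; lookup)
open import Data.Vec.Properties using (≡-dec)
import Data.Bool.Properties as BoolP
open import Data.List as List using (List; []; _∷_; _++_; map; filter; length; allFin)
open import Data.Bool.ListAction using (any; all)
open import Data.Product using (Σ; _×_; _,_)
open import Data.Sum using (_⊎_)
open import Function using (_∘_)
open import Relation.Nullary using (¬_)
open import Relation.Nullary.Decidable using (⌊_⌋)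
open import Relation.Binary.PropositionalEquality using (_≡_)

-- GF(2) vector space 2^E, E = Fin m, subsets as Vec Bool m

Vect : ℕ → Set
Vect m = Subset m

_⊕_ : ∀ {m} → Vect m → Vect m → Vect m
_⊕_ = zipWith _xor_

zeroV : ∀ {m} → Vect m
zeroV = replicate _ false

_==V_ : ∀ {m} → Vect m → Vect m → Bool
u ==V v = ⌊ ≡-dec BoolP._≟_ u v ⌋

orth : ∀ {m} → Vect m → Vect m → Bool
orth u w = (∣ u ∩ w ∣ % 2) ≡ᵇ 0

allVecs : ∀ m → List (Vect m)
allVecs zero    = [] ∷ []
allVecs (suc m) = map (false ∷_) (allVecs m) ++ map (true ∷_) (allVecs m)

sums : ∀ {m} → List (Vect m) → List (Vect m)
sums []       = zeroV ∷ []
sums (g ∷ gs) = sums gs ++ map (g ⊕_) (sums gs)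

inSpan : ∀ {m} → List (Vect m) → Vect m → Bool
inSpan gs v = any (v ==V_) (sums gs)

inPerp : ∀ {m} → List (Vect m) → Vect m → Bool
inPerp gs u = all (orth u) (sums gs)

card : ∀ {m} → (Vect m → Bool) → ℕ
card {m} P = length (filter (λ v → P v BoolP.≟ true) (allVecs m))

-- dimension over GF(2) of a subspace (given by its membership test):
-- a GF(2)-space of dimension d has exactly 2^d elements
dim : ∀ {m} → (Vect m → Bool) → ℕ
dim P = ⌊log₂ card P ⌋

-- Cellularly embedded graphs as combinatorial maps (graph-encoded maps):
-- flags Fin n, three fixed-point-free involutions τ₀ τ₁ τ₂ with
-- τ₀τ₂ = τ₂τ₀ fixed-point-free, and the monodromy group transitive.
-- vertices = orbits of ⟨τ₁,τ₂⟩, edges = orbits of ⟨τ₀,τ₂⟩,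
-- faces = orbits of ⟨τ₀,τ₁⟩, zigzag paths = orbits of ⟨τ₀τ₂,τ₁⟩.
-- The edges are labelled by E = Fin m via edgeOf.

within : ∀ {n} → List (Fin n → Fin n) → ℕ → Fin n → Fin n → Bool
within gens zero    x y = ⌊ x FinP.≟ y ⌋
within gens (suc k) x y = within gens k x y ∨ any (λ g → within gens k (g x) y) gens

sameOrbit : ∀ {n} → List (Fin n → Fin n) → Fin n → Fin n → Bool
sameOrbit {n} gens = within gens n

record Map (n m : ℕ) : Set where
  field
    τ₀ τ₁ τ₂ : Fin n → Fin n
    τ₀-inv : ∀ x → τ₀ (τ₀ x) ≡ x
    τ₁-inv : ∀ x → τ₁ (τ₁ x) ≡ x
    τ₂-inv : ∀ x → τ₂ (τ₂ x) ≡ x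
    τ₀-fpf : ∀ x → ¬ (τ₀ x ≡ x)
    τ₁-fpf : ∀ x → ¬ (τ₁ x ≡ x)
    τ₂-fpf : ∀ x → ¬ (τ₂ x ≡ x)
    τ₀τ₂-comm : ∀ x → τ₀ (τ₂ x) ≡ τ₂ (τ₀ x)
    τ₀τ₂-fpf : ∀ x → ¬ (τ₀ (τ₂ x) ≡ x)
    connected : ∀ x y → sameOrbit (τ₀ ∷ τ₁ ∷ τ₂ ∷ []) x y ≡ true
    edgeOf : Fin n → Fin m
    edgeOf-onto : ∀ e → Σ (Fin n) (λ x → edgeOf x ≡ e)
    edgeOf-same : ∀ x y → edgeOf x ≡ edgeOf y →
      (y ≡ x) ⊎ (y ≡ τ₀ x) ⊎ (y ≡ τ₂ x) ⊎ (y ≡ τ₀ (τ₂ x))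
    edgeOf-τ₀ : ∀ x → edgeOf (τ₀ x) ≡ edgeOf x
    edgeOf-τ₂ : ∀ x → edgeOf (τ₂ x) ≡ edgeOf x

module _ {n m : ℕ} (M : Map n m) where
  open Map M

  flags : List (Fin n)
  flags = allFin n

  vertexGens faceGens zigzagGens : List (Fin n → Fin n)
  vertexGens = τ₁ ∷ τ₂ ∷ []
  faceGens   = τ₀ ∷ τ₁ ∷ []
  zigzagGens = (τ₀ ∘ τ₂) ∷ τ₁ ∷ []

  -- coboundary of the vertex containing flag x: the non-loop edges
  -- incident with it, i.e. edges e having a flag y at this vertex whose
  -- other end (the vertex of τ₀ y) is a different vertex
  coboundary : Fin n → Vect m
  coboundary x = tabulate λ e → any (λ y →
      ⌊ edgeOf y FinP.≟ e ⌋ ∧ sameOrbit vertexGens x y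
        ∧ not (sameOrbit vertexGens x (τ₀ y))) flags

  -- number of times the closed walk (face boundary / zigzag path) given
  -- by the orbit of x under gens traverses edge e: each traversal uses
  -- two flags of e in the orbit
  traversals : List (Fin n → Fin n) → Fin n → Fin m → ℕ
  traversals gens x e =
    length (filter (λ y → (⌊ edgeOf y FinP.≟ e ⌋ ∧ sameOrbit gens x y) BoolP.≟ true) flags) / 2

  oddTraversed : List (Fin n → Fin n) → Fin n → Vect m
  oddTraversed gens x = tabulate λ e → (traversals gens x e % 2) ≡ᵇ 1

  faceBoundary zigzag : Fin n → Vect m
  faceBoundary = oddTraversed faceGens
  zigzag       = oddTraversed zigzagGens

  -- spanning lists for 𝒱₁, 𝒱₂, 𝒱₃ (one generator per flag; repeats harmless)
  gens : Fin 3 → List (Vect m)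
  gens Fin.zero             = map coboundary flags
  gens (Fin.suc Fin.zero)   = map faceBoundary flags
  gens (Fin.suc (Fin.suc _)) = map zigzag flags

  -- cdef(G_i) = dim (𝒱_i^⊥ / (𝒱_j + 𝒱_k)),  {i,j,k} = {1,2,3};
  -- since 𝒱_j + 𝒱_k ⊆ 𝒱_i^⊥ this is dim 𝒱_i^⊥ − dim (𝒱_j + 𝒱_k)
  cdef : (i j k : Fin 3) → ℕ
  cdef i j k = dim (inPerp (gens i)) ∸ dim (inSpan (gens j ++ gens k))

-- Since dim 𝒱ᵢ^⊥ = |E| − dim 𝒱ᵢ and dim (𝒱ⱼ + 𝒱ₖ) = dim 𝒱ⱼ + dim 𝒱ₖ − dim (𝒱ⱼ ∩ 𝒱ₖ),
-- cdef(Gᵢ) = |E| + dim (𝒱ⱼ ∩ 𝒱ₖ) − dim 𝒱₁ − dim 𝒱₂ − dim 𝒱₃, so it suffices that any two of the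
-- spaces meet inside the third. Both dimension identities are proved by counting, dim being log₂ of
-- a cardinality. An edge set X lies in 𝒱₁ (resp. 𝒱₂, 𝒱₃) iff some τ₁-invariant 2-colouring of the
-- flags changes across τ₀ exactly on X and never across τ₂ (resp. across τ₂ exactly on X and never
-- across τ₀; across both τ₀ and τ₂ exactly on X): such colourings are the sums of indicators of
-- vertices (resp. faces, zigzags). The sum of colourings for two of the spaces is one for the third.

module Submission where

open import Defs
open import Algebra.Bundles using (CommutativeSemigroup)
import Algebra.Properties.CommutativeSemigroup as CommutativeSemigroupProperties
open import Data.Bool using (Bool; true; false; _∧_; _∨_; not; _xor_)
import Data.Bool.Properties as Bool
open import Data.Bool.ListAction using (or; any; all)
open import Data.Empty using (⊥-elim)
open import Data.Fin using (Fin; zero; suc)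
import Data.Fin.Properties as Fin
open import Data.Fin.Subset using (_∩_; ∣_∣)
open import Data.List using (List; []; _∷_; _++_; map; filter; length; allFin; tabulate)
import Data.List.Properties as Listₚ
open import Data.List.Membership.Propositional using (_∈_; lose)
open import Data.List.Membership.Propositional.Properties using (∈-allFin; ∈-++⁺ˡ; ∈-++⁺ʳ; ∈-map⁺; ∈-filter⁺; ∈-filter⁻)
open import Data.List.Relation.Unary.All as All using ([]; _∷_)
open import Data.List.Relation.Unary.AllPairs using ([]; _∷_)
open import Data.List.Relation.Unary.Any using (Any; here; there)
open import Data.List.Relation.Unary.Unique.Propositional using (Unique)
open import Data.Nat using (ℕ; zero; suc; _+_; _*_; _^_; _∸_; _/_; _%_; _≡ᵇ_; _≤_; s≤s)
open import Data.Nat.ListAction using (sum)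
open import Data.Nat.ListAction.Properties using (sum-++)
open import Data.Nat.Logarithm using (⌊log₂_⌋; ⌊log₂[2^n]⌋≡n)
open import Data.Nat.Properties
  using ( +-comm; +-identityʳ; +-cancelʳ-≡; +-commutativeSemigroup; *-comm; *-assoc; *-zeroʳ; *-identityʳ
        ; *-distribˡ-+; *-commutativeSemigroup; ^-distribˡ-+-*; [m+n]∸[m+o]≡n∸o; ≤-trans; <⇒≱; m<m+n )
open import Data.Product using (_×_; _,_; proj₁; proj₂; ∃)
open import Data.Sum using (_⊎_; inj₁; inj₂)
open import Data.Vec using ([]; _∷_; lookup)
import Data.Vec as Vec
import Data.Vec.Properties as Vecₚ
open import Function using (_∘_; id; case_of_)
open import Level using (0ℓ)
open import Relation.Nullary using (Dec; yes; no)
open import Relation.Nullary.Decidable using (⌊_⌋)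
open import Relation.Binary.PropositionalEquality
open ≡-Reasoning

bool-ext : ∀ {a b : Bool} → (a ≡ true → b ≡ true) → (b ≡ true → a ≡ true) → a ≡ b
bool-ext {false} {false} _ _ = refl
bool-ext {false} {true}  _ b⇒a = b⇒a refl
bool-ext {true}  a⇒b _ = sym (a⇒b refl)

⌊⌋-sound : ∀ {A : Set} (a? : Dec A) → ⌊ a? ⌋ ≡ true → A
⌊⌋-sound (yes a) _ = a

⌊⌋-complete : ∀ {A : Set} (a? : Dec A) → A → ⌊ a? ⌋ ≡ true
⌊⌋-complete (yes _) _ = refl
⌊⌋-complete (no ¬a) a = ⊥-elim (¬a a)

∨-true⁻ : ∀ {a b : Bool} → a ∨ b ≡ true → a ≡ true ⊎ b ≡ true
∨-true⁻ {true}  _ = inj₁ refl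
∨-true⁻ {false} b = inj₂ b

∨-trueˡ : ∀ {a} b → a ≡ true → a ∨ b ≡ true
∨-trueˡ _ refl = refl

∨-trueʳ : ∀ a {b} → b ≡ true → a ∨ b ≡ true
∨-trueʳ true  _ = refl
∨-trueʳ false b = b

∧-true⁻ : ∀ {a b : Bool} → a ∧ b ≡ true → a ≡ true × b ≡ true
∧-true⁻ {true} b = refl , b

∧-true⁺ : ∀ {a b : Bool} → a ≡ true → b ≡ true → a ∧ b ≡ true
∧-true⁺ refl b = b

xor-cancelˡ : ∀ a b → a xor (a xor b) ≡ b
xor-cancelˡ a b = trans (sym (Bool.xor-assoc a a b)) (cong (_xor b) (Bool.xor-same a))

xor-cancelʳ : ∀ a b → (a xor b) xor b ≡ a
xor-cancelʳ a b = trans (Bool.xor-assoc a b b) (trans (cong (a xor_) (Bool.xor-same b)) (Bool.xor-identityʳ a))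

commutativeSemigroup : ∀ {A : Set} (_∙_ : A → A → A) →
  (∀ x y z → (x ∙ y) ∙ z ≡ x ∙ (y ∙ z)) → (∀ x y → x ∙ y ≡ y ∙ x) → CommutativeSemigroup 0ℓ 0ℓ
commutativeSemigroup _∙_ assoc comm = record
  { _∙_ = _∙_
  ; isCommutativeSemigroup = record
    { isSemigroup = record { isMagma = isMagma _∙_ ; assoc = assoc }
    ; comm = comm
    }
  }

module xor-Properties = CommutativeSemigroupProperties (commutativeSemigroup _xor_ Bool.xor-assoc Bool.xor-comm)
module ℕ-+ = CommutativeSemigroupProperties +-commutativeSemigroup
module ℕ-* = CommutativeSemigroupProperties *-commutativeSemigroup

any-++ : ∀ {A : Set} (p : A → Bool) xs ys → any p (xs ++ ys) ≡ any p xs ∨ any p ys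
any-++ p []       ys = refl
any-++ p (x ∷ xs) ys = trans (cong (p x ∨_) (any-++ p xs ys)) (sym (Bool.∨-assoc (p x) _ _))

any-map : ∀ {A B : Set} (p : B → Bool) (f : A → B) xs → any p (map f xs) ≡ any (p ∘ f) xs
any-map p f xs = cong or (sym (Listₚ.map-∘ xs))

any-cong : ∀ {A : Set} {p q : A → Bool} → (∀ x → p x ≡ q x) → ∀ xs → any p xs ≡ any q xs
any-cong p≗q xs = cong or (Listₚ.map-cong p≗q xs)

any-∈ : ∀ {A : Set} (p : A → Bool) {xs x} → x ∈ xs → p x ≡ true → any p xs ≡ true
any-∈ p {y ∷ _} (here refl)  px = ∨-trueˡ _ px
any-∈ p {y ∷ _} (there x∈xs) px = ∨-trueʳ (p y) (any-∈ p x∈xs px)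

any-∃ : ∀ {A : Set} (p : A → Bool) xs → any p xs ≡ true → ∃ λ x → x ∈ xs × p x ≡ true
any-∃ p (x ∷ xs) any≡ with ∨-true⁻ {p x} any≡
... | inj₁ px   = x , here refl , px
... | inj₂ rest = let y , y∈xs , py = any-∃ p xs rest in y , there y∈xs , py

all-∈ : ∀ {A : Set} (p : A → Bool) {xs x} → all p xs ≡ true → x ∈ xs → p x ≡ true
all-∈ p {x ∷ _} all≡ (here refl)  = proj₁ (∧-true⁻ {p x} all≡)
all-∈ p {x ∷ _} all≡ (there x∈xs) = all-∈ p (proj₂ (∧-true⁻ {p x} all≡)) x∈xs

all-complete : ∀ {A : Set} (p : A → Bool) xs → (∀ {x} → x ∈ xs → p x ≡ true) → all p xs ≡ true
all-complete p []       _      = refl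
all-complete p (x ∷ xs) p-true = ∧-true⁺ (p-true (here refl)) (all-complete p xs (p-true ∘ there))

all-false⁻ : ∀ {A : Set} (p : A → Bool) xs → all p xs ≡ false → ∃ λ x → x ∈ xs × p x ≡ false
all-false⁻ p (x ∷ xs) all≡ with p x in px
... | false = x , here refl , px
... | true  = let y , y∈xs , py = all-false⁻ p xs all≡ in y , there y∈xs , py

toℕ : Bool → ℕ
toℕ false = 0
toℕ true  = 1

count : ∀ {A : Set} → (A → Bool) → List A → ℕ
count P xs = length (filter (λ x → P x Bool.≟ true) xs)

count≡sum : ∀ {A : Set} (P : A → Bool) xs → count P xs ≡ sum (map (toℕ ∘ P) xs)
count≡sum P []       = refl
count≡sum P (x ∷ xs) with P x
... | true  = cong suc (count≡sum P xs)
... | false = count≡sum P xs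

sum-map-cong : ∀ {A : Set} {f g : A → ℕ} → (∀ x → f x ≡ g x) → ∀ xs → sum (map f xs) ≡ sum (map g xs)
sum-map-cong f≗g xs = cong sum (Listₚ.map-cong f≗g xs)

sum-map-+ : ∀ {A : Set} (f g : A → ℕ) xs →
  sum (map (λ x → f x + g x) xs) ≡ sum (map f xs) + sum (map g xs)
sum-map-+ f g []       = refl
sum-map-+ f g (x ∷ xs) = begin
  (f x + g x) + sum (map (λ x → f x + g x) xs)      ≡⟨ cong ((f x + g x) +_) (sum-map-+ f g xs) ⟩
  (f x + g x) + (sum (map f xs) + sum (map g xs))   ≡⟨ ℕ-+.interchange (f x) (g x) _ _ ⟩
  (f x + sum (map f xs)) + (g x + sum (map g xs))   ∎

sum-map-*ˡ : ∀ {A : Set} (k : ℕ) (f : A → ℕ) xs → sum (map (λ x → k * f x) xs) ≡ k * sum (map f xs)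
sum-map-*ˡ k f []       = sym (*-zeroʳ k)
sum-map-*ˡ k f (x ∷ xs) = begin
  k * f x + sum (map (λ x → k * f x) xs)  ≡⟨ cong (k * f x +_) (sum-map-*ˡ k f xs) ⟩
  k * f x + k * sum (map f xs)            ≡⟨ *-distribˡ-+ k (f x) _ ⟨
  k * (f x + sum (map f xs))              ∎

sum-map-zero : ∀ {A : Set} (xs : List A) → sum (map (λ _ → 0) xs) ≡ 0
sum-map-zero []       = refl
sum-map-zero (_ ∷ xs) = sum-map-zero xs

sum-map-swap : ∀ {A B : Set} (f : A → B → ℕ) xs ys →
  sum (map (λ x → sum (map (f x) ys)) xs) ≡ sum (map (λ y → sum (map (λ x → f x y) xs)) ys)
sum-map-swap f []       ys = sym (sum-map-zero ys)
sum-map-swap f (x ∷ xs) ys = begin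
  sum (map (f x) ys) + sum (map (λ x → sum (map (f x) ys)) xs)
    ≡⟨ cong (sum (map (f x) ys) +_) (sum-map-swap f xs ys) ⟩
  sum (map (f x) ys) + sum (map (λ y → sum (map (λ x → f x y) xs)) ys)
    ≡⟨ sum-map-+ (f x) (λ y → sum (map (λ x → f x y) xs)) ys ⟨
  sum (map (λ y → f x y + sum (map (λ x → f x y) xs)) ys)  ∎

count-swap : ∀ {A B : Set} (R : A → B → Bool) xs ys →
  sum (map (λ x → count (R x) ys) xs) ≡ sum (map (λ y → count (λ x → R x y) xs) ys)
count-swap R xs ys = begin
  sum (map (λ x → count (R x) ys) xs)                   ≡⟨ sum-map-cong (λ x → count≡sum (R x) ys) xs ⟩
  sum (map (λ x → sum (map (toℕ ∘ R x) ys)) xs)         ≡⟨ sum-map-swap (λ x y → toℕ (R x y)) xs ys ⟩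
  sum (map (λ y → sum (map (λ x → toℕ (R x y)) xs)) ys) ≡⟨ sum-map-cong (λ y → count≡sum (λ x → R x y) xs) ys ⟨
  sum (map (λ y → count (λ x → R x y) xs) ys)           ∎

count-∷ : ∀ {A : Set} (P : A → Bool) x xs → count P (x ∷ xs) ≡ toℕ (P x) + count P xs
count-∷ P x xs with P x
... | true  = refl
... | false = refl

count-none : ∀ {A : Set} (xs : List A) → count (λ _ → false) xs ≡ 0
count-none []       = refl
count-none (_ ∷ xs) = count-none xs

count-pos : ∀ {A : Set} {P : A → Bool} {x xs} → x ∈ xs → P x ≡ true → 1 ≤ count P xs
count-pos {P = P} x∈xs Px = Listₚ.filter-some (λ x → P x Bool.≟ true) (lose x∈xs Px)

count-cong : ∀ {A : Set} {P Q : A → Bool} → (∀ x → P x ≡ Q x) → ∀ xs → count P xs ≡ count Q xs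
count-cong {P = P} {Q} P≗Q xs = begin
  count P xs               ≡⟨ count≡sum P xs ⟩
  sum (map (toℕ ∘ P) xs)   ≡⟨ sum-map-cong (cong toℕ ∘ P≗Q) xs ⟩
  sum (map (toℕ ∘ Q) xs)   ≡⟨ count≡sum Q xs ⟨
  count Q xs               ∎

count-++ : ∀ {A : Set} (P : A → Bool) xs ys → count P (xs ++ ys) ≡ count P xs + count P ys
count-++ P xs ys = begin
  count P (xs ++ ys)                                   ≡⟨ count≡sum P (xs ++ ys) ⟩
  sum (map (toℕ ∘ P) (xs ++ ys))                       ≡⟨ cong sum (Listₚ.map-++ (toℕ ∘ P) xs ys) ⟩
  sum (map (toℕ ∘ P) xs ++ map (toℕ ∘ P) ys)           ≡⟨ sum-++ (map (toℕ ∘ P) xs) _ ⟩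
  sum (map (toℕ ∘ P) xs) + sum (map (toℕ ∘ P) ys)      ≡⟨ cong₂ _+_ (count≡sum P xs) (count≡sum P ys) ⟨
  count P xs + count P ys                              ∎

count-map : ∀ {A B : Set} (P : B → Bool) (f : A → B) xs → count P (map f xs) ≡ count (P ∘ f) xs
count-map P f xs = begin
  count P (map f xs)                  ≡⟨ count≡sum P (map f xs) ⟩
  sum (map (toℕ ∘ P) (map f xs))      ≡⟨ cong sum (Listₚ.map-∘ xs) ⟨
  sum (map (toℕ ∘ P ∘ f) xs)          ≡⟨ count≡sum (P ∘ f) xs ⟨
  count (P ∘ f) xs                    ∎

count-split : ∀ {A : Set} (P Q : A → Bool) xs →
  count P xs ≡ count (λ x → P x ∧ Q x) xs + count (λ x → P x ∧ not (Q x)) xs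
count-split P Q xs = begin
  count P xs                                                   ≡⟨ count≡sum P xs ⟩
  sum (map (toℕ ∘ P) xs)                                       ≡⟨ sum-map-cong (λ x → toℕ-split (P x) (Q x)) xs ⟩
  sum (map (λ x → toℕ (P x ∧ Q x) + toℕ (P x ∧ not (Q x))) xs) ≡⟨ sum-map-+ _ _ xs ⟩
  sum (map (λ x → toℕ (P x ∧ Q x)) xs) + sum (map (λ x → toℕ (P x ∧ not (Q x))) xs)
    ≡⟨ cong₂ _+_ (count≡sum (λ x → P x ∧ Q x) xs) (count≡sum (λ x → P x ∧ not (Q x)) xs) ⟨
  count (λ x → P x ∧ Q x) xs + count (λ x → P x ∧ not (Q x)) xs ∎
  where
  toℕ-split : ∀ a b → toℕ a ≡ toℕ (a ∧ b) + toℕ (a ∧ not b)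
  toℕ-split false _     = refl
  toℕ-split true  false = refl
  toℕ-split true  true  = refl

count-∨-disjoint : ∀ {A : Set} (P Q : A → Bool) → (∀ x → P x ∧ Q x ≡ false) →
  ∀ xs → count (λ x → P x ∨ Q x) xs ≡ count P xs + count Q xs
count-∨-disjoint P Q disjoint xs = begin
  count (λ x → P x ∨ Q x) xs
    ≡⟨ count-split (λ x → P x ∨ Q x) P xs ⟩
  count (λ x → (P x ∨ Q x) ∧ P x) xs + count (λ x → (P x ∨ Q x) ∧ not (P x)) xs
    ≡⟨ cong₂ _+_ (count-cong left xs) (count-cong right xs) ⟩
  count P xs + count Q xs  ∎
  where
  left : ∀ x → (P x ∨ Q x) ∧ P x ≡ P x
  left x with P x
  ... | true  = refl
  ... | false = Bool.∧-zeroʳ (Q x)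
  right : ∀ x → (P x ∨ Q x) ∧ not (P x) ≡ Q x
  right x with P x | disjoint x
  ... | true  | Q≡false = sym Q≡false
  ... | false | _       = Bool.∧-identityʳ (Q x)

-- The vector space 2^E

⊕-comm : ∀ {m} (u v : Vect m) → u ⊕ v ≡ v ⊕ u
⊕-comm = Vecₚ.zipWith-comm Bool.xor-comm

⊕-assoc : ∀ {m} (u v w : Vect m) → (u ⊕ v) ⊕ w ≡ u ⊕ (v ⊕ w)
⊕-assoc = Vecₚ.zipWith-assoc Bool.xor-assoc

⊕-identityˡ : ∀ {m} (u : Vect m) → zeroV ⊕ u ≡ u
⊕-identityˡ = Vecₚ.zipWith-identityˡ Bool.xor-identityˡ

⊕-identityʳ : ∀ {m} (u : Vect m) → u ⊕ zeroV ≡ u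
⊕-identityʳ = Vecₚ.zipWith-identityʳ Bool.xor-identityʳ

⊕-self : ∀ {m} (u : Vect m) → u ⊕ u ≡ zeroV
⊕-self []      = refl
⊕-self (a ∷ u) = cong₂ _∷_ (Bool.xor-same a) (⊕-self u)

⊕-cancelˡ : ∀ {m} (a v : Vect m) → a ⊕ (a ⊕ v) ≡ v
⊕-cancelˡ a v = begin
  a ⊕ (a ⊕ v)  ≡⟨ ⊕-assoc a a v ⟨
  (a ⊕ a) ⊕ v  ≡⟨ cong (_⊕ v) (⊕-self a) ⟩
  zeroV ⊕ v    ≡⟨ ⊕-identityˡ v ⟩
  v            ∎

⊕-cancelʳ : ∀ {m} (a v : Vect m) → (a ⊕ v) ⊕ v ≡ a
⊕-cancelʳ a v = begin
  (a ⊕ v) ⊕ v  ≡⟨ ⊕-assoc a v v ⟩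
  a ⊕ (v ⊕ v)  ≡⟨ cong (a ⊕_) (⊕-self v) ⟩
  a ⊕ zeroV    ≡⟨ ⊕-identityʳ a ⟩
  a            ∎

module ⊕-Properties {m} = CommutativeSemigroupProperties (commutativeSemigroup (_⊕_ {m}) ⊕-assoc ⊕-comm)

tabulate-xor : ∀ {m} (f g : Fin m → Bool) → Vec.tabulate (λ i → f i xor g i) ≡ Vec.tabulate f ⊕ Vec.tabulate g
tabulate-xor {zero}  f g = refl
tabulate-xor {suc m} f g = cong ((f zero xor g zero) ∷_) (tabulate-xor (f ∘ suc) (g ∘ suc))

==V-sound : ∀ {m} {u v : Vect m} → (u ==V v) ≡ true → u ≡ v
==V-sound = ⌊⌋-sound (Vecₚ.≡-dec Bool._≟_ _ _)

==V-complete : ∀ {m} {u v : Vect m} → u ≡ v → (u ==V v) ≡ true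
==V-complete = ⌊⌋-complete (Vecₚ.≡-dec Bool._≟_ _ _)

any-==V⁻ : ∀ {m} {v : Vect m} xs → any (v ==V_) xs ≡ true → v ∈ xs
any-==V⁻ {v = v} (x ∷ xs) any≡ with ∨-true⁻ {v ==V x} any≡
... | inj₁ v≡x   = here (==V-sound v≡x)
... | inj₂ v∈xs  = there (any-==V⁻ xs v∈xs)

any-==V⁺ : ∀ {m} {v : Vect m} {xs} → v ∈ xs → any (v ==V_) xs ≡ true
any-==V⁺ {v = v}         (here refl)  = ∨-trueˡ _ (==V-complete {u = v} refl)
any-==V⁺ {v = v} {x ∷ _} (there v∈xs) = ∨-trueʳ (v ==V x) (any-==V⁺ v∈xs)

∈-allVecs : ∀ {m} (v : Vect m) → v ∈ allVecs m
∈-allVecs []                = here refl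
∈-allVecs {suc m} (false ∷ v) = ∈-++⁺ˡ (∈-map⁺ (false ∷_) (∈-allVecs v))
∈-allVecs {suc m} (true ∷ v)  = ∈-++⁺ʳ (map (false ∷_) (allVecs m)) (∈-map⁺ (true ∷_) (∈-allVecs v))

card-cong : ∀ {m} {P Q : Vect m → Bool} → (∀ v → P v ≡ Q v) → card P ≡ card Q
card-cong {m} P≗Q = count-cong P≗Q (allVecs m)

card-∷ : ∀ {m} (P : Vect (suc m) → Bool) → card P ≡ card (P ∘ (false ∷_)) + card (P ∘ (true ∷_))
card-∷ {m} P = begin
  card P
    ≡⟨ count-++ P (map (false ∷_) (allVecs m)) _ ⟩
  count P (map (false ∷_) (allVecs m)) + count P (map (true ∷_) (allVecs m))
    ≡⟨ cong₂ _+_ (count-map P (false ∷_) (allVecs m)) (count-map P (true ∷_) (allVecs m)) ⟩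
  card (P ∘ (false ∷_)) + card (P ∘ (true ∷_))  ∎

card-const-true : ∀ m → card {m} (λ _ → true) ≡ 2 ^ m
card-const-true zero    = refl
card-const-true (suc m) = begin
  card {suc m} (λ _ → true)                            ≡⟨ card-∷ {m} (λ _ → true) ⟩
  card {m} (λ _ → true) + card {m} (λ _ → true)        ≡⟨ cong₂ _+_ (card-const-true m) (card-const-true m) ⟩
  2 ^ m + 2 ^ m                                        ≡⟨ cong (2 ^ m +_) (+-identityʳ (2 ^ m)) ⟨
  2 ^ suc m                                            ∎

==V-zeroV-false∷ : ∀ {m} (v : Vect m) → ((false ∷ v) ==V zeroV) ≡ (v ==V zeroV)
==V-zeroV-false∷ v = bool-ext (λ h → ==V-complete (Vecₚ.∷-injectiveʳ (==V-sound h)))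
                              (λ h → ==V-complete (cong (false ∷_) (==V-sound h)))

==V-zeroV-true∷ : ∀ {m} (v : Vect m) → ((true ∷ v) ==V zeroV) ≡ false
==V-zeroV-true∷ v = Bool.¬-not {y = true} λ h → case Vecₚ.∷-injectiveˡ (==V-sound {u = true ∷ v} {zeroV} h) of λ ()

card-zeroV : ∀ m → card {m} (_==V zeroV) ≡ 1
card-zeroV zero    = refl
card-zeroV (suc m) = begin
  card {suc m} (_==V zeroV)                                          ≡⟨ card-∷ {m} (_==V zeroV) ⟩
  card {m} (λ v → (false ∷ v) ==V zeroV) + card {m} (λ v → (true ∷ v) ==V zeroV)
    ≡⟨ cong₂ _+_ (card-cong {m} ==V-zeroV-false∷) (card-cong {m} ==V-zeroV-true∷) ⟩
  card {m} (_==V zeroV) + card {m} (λ _ → false)                     ≡⟨ cong₂ _+_ (card-zeroV m) (count-none (allVecs m)) ⟩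
  1                                                                  ∎

card-translate : ∀ {m} (P : Vect m → Bool) (c : Vect m) → card (λ v → P (v ⊕ c)) ≡ card P
card-translate {zero}  P []      = card-cong {P = λ v → P (v ⊕ [])} {P} λ { [] → refl }
card-translate {suc m} P (b ∷ c) = begin
  card (λ v → P (v ⊕ (b ∷ c)))
    ≡⟨ card-∷ {m} (λ v → P (v ⊕ (b ∷ c))) ⟩
  card (λ v → P (b ∷ (v ⊕ c))) + card (λ v → P (not b ∷ (v ⊕ c)))
    ≡⟨ cong₂ _+_ (card-translate (P ∘ (b ∷_)) c) (card-translate (P ∘ (not b ∷_)) c) ⟩
  card (P ∘ (b ∷_)) + card (P ∘ (not b ∷_))
    ≡⟨ reorder b ⟩
  card (P ∘ (false ∷_)) + card (P ∘ (true ∷_))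
    ≡⟨ card-∷ {m} P ⟨
  card P  ∎
  where
  reorder : ∀ b → card (P ∘ (b ∷_)) + card (P ∘ (not b ∷_)) ≡ card (P ∘ (false ∷_)) + card (P ∘ (true ∷_))
  reorder false = refl
  reorder true  = +-comm (card (P ∘ (true ∷_))) _

card-split : ∀ {m} (P Q : Vect m → Bool) → card P ≡ card (λ v → P v ∧ Q v) + card (λ v → P v ∧ not (Q v))
card-split {m} P Q = count-split P Q (allVecs m)

card-∨-disjoint : ∀ {m} (P Q : Vect m → Bool) → (∀ v → P v ∧ Q v ≡ false) →
  card (λ v → P v ∨ Q v) ≡ card P + card Q
card-∨-disjoint {m} P Q disjoint = count-∨-disjoint P Q disjoint (allVecs m)

sum-indicators : ∀ {m} (a b : ℕ) (P Q : Vect m → Bool) →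
  sum (map (λ v → a * toℕ (P v) + b * toℕ (Q v)) (allVecs m)) ≡ a * card P + b * card Q
sum-indicators {m} a b P Q = begin
  sum (map (λ v → a * toℕ (P v) + b * toℕ (Q v)) A)
    ≡⟨ sum-map-+ (λ v → a * toℕ (P v)) (λ v → b * toℕ (Q v)) A ⟩
  sum (map (λ v → a * toℕ (P v)) A) + sum (map (λ v → b * toℕ (Q v)) A)
    ≡⟨ cong₂ _+_ (sum-map-*ˡ a (toℕ ∘ P) A) (sum-map-*ˡ b (toℕ ∘ Q) A) ⟩
  a * sum (map (toℕ ∘ P) A) + b * sum (map (toℕ ∘ Q) A)
    ≡⟨ cong₂ _+_ (cong (a *_) (count≡sum P A)) (cong (b *_) (count≡sum Q A)) ⟨
  a * card P + b * card Q  ∎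
  where A = allVecs m

-- Subspaces and spans

record IsSubspace {m} (P : Vect m → Bool) : Set where
  field
    zero∈    : P zeroV ≡ true
    ⊕-closed : ∀ {u v} → P u ≡ true → P v ≡ true → P (u ⊕ v) ≡ true

module _ {m} {P : Vect m → Bool} (S : IsSubspace P) where
  open IsSubspace S

  translate-member : ∀ {a} → P a ≡ true → ∀ v → P (a ⊕ v) ≡ P v
  translate-member {a} Pa v = bool-ext
    (λ Pav → subst (λ x → P x ≡ true) (⊕-cancelˡ a v) (⊕-closed Pa Pav))
    (⊕-closed Pa)

  translate-nonmember : ∀ {g} → P g ≡ false → ∀ v → P v ∧ P (g ⊕ v) ≡ false
  translate-nonmember {g} Pg≡false v = Bool.¬-not {y = true} λ both →
    let Pv , Pgv = ∧-true⁻ both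
        Pg = subst (λ x → P x ≡ true) (trans (⊕-comm v (g ⊕ v)) (⊕-cancelʳ g v)) (⊕-closed Pv Pgv)
    in case trans (sym Pg) Pg≡false of λ ()

  card-coset-union : ∀ {g} → P g ≡ false → card (λ v → P v ∨ P (g ⊕ v)) ≡ 2 * card P
  card-coset-union {g} Pg≡false = begin
    card (λ v → P v ∨ P (g ⊕ v))   ≡⟨ card-∨-disjoint P (λ v → P (g ⊕ v)) (translate-nonmember Pg≡false) ⟩
    card P + card (λ v → P (g ⊕ v)) ≡⟨ cong (card P +_) (trans (card-cong (λ v → cong P (⊕-comm g v))) (card-translate P g)) ⟩
    card P + card P                 ≡⟨ cong (card P +_) (+-identityʳ (card P)) ⟨
    2 * card P                      ∎

inSpan-[] : ∀ {m} (v : Vect m) → inSpan [] v ≡ (v ==V zeroV)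
inSpan-[] v = Bool.∨-identityʳ (v ==V zeroV)

inSpan-∷ : ∀ {m} (g : Vect m) gs v → inSpan (g ∷ gs) v ≡ inSpan gs v ∨ inSpan gs (g ⊕ v)
inSpan-∷ g gs v = begin
  any (v ==V_) (sums gs ++ map (g ⊕_) (sums gs))          ≡⟨ any-++ (v ==V_) (sums gs) _ ⟩
  inSpan gs v ∨ any (v ==V_) (map (g ⊕_) (sums gs))        ≡⟨ cong (inSpan gs v ∨_) (any-map (v ==V_) (g ⊕_) (sums gs)) ⟩
  inSpan gs v ∨ any (λ w → v ==V (g ⊕ w)) (sums gs)        ≡⟨ cong (inSpan gs v ∨_) (any-cong shift (sums gs)) ⟩
  inSpan gs v ∨ inSpan gs (g ⊕ v)                          ∎
  where
  shift : ∀ w → (v ==V (g ⊕ w)) ≡ ((g ⊕ v) ==V w)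
  shift w = bool-ext
    (λ h → ==V-complete (trans (cong (g ⊕_) (==V-sound h)) (⊕-cancelˡ g w)))
    (λ h → ==V-complete (trans (sym (⊕-cancelˡ g v)) (cong (g ⊕_) (==V-sound h))))

module _ {m} (g : Vect m) (gs : List (Vect m)) where

  inSpan-∷⁻ : ∀ {v} → inSpan (g ∷ gs) v ≡ true → inSpan gs v ≡ true ⊎ inSpan gs (g ⊕ v) ≡ true
  inSpan-∷⁻ {v} h = ∨-true⁻ (trans (sym (inSpan-∷ g gs v)) h)

  inSpan-∷⁺ˡ : ∀ {v} → inSpan gs v ≡ true → inSpan (g ∷ gs) v ≡ true
  inSpan-∷⁺ˡ {v} h = trans (inSpan-∷ g gs v) (∨-trueˡ _ h)

  inSpan-∷⁺ʳ : ∀ {v} → inSpan gs (g ⊕ v) ≡ true → inSpan (g ∷ gs) v ≡ true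
  inSpan-∷⁺ʳ {v} h = trans (inSpan-∷ g gs v) (∨-trueʳ _ h)

inSpan-zero : ∀ {m} (gs : List (Vect m)) → inSpan gs zeroV ≡ true
inSpan-zero []       = trans (inSpan-[] zeroV) (==V-complete refl)
inSpan-zero (g ∷ gs) = inSpan-∷⁺ˡ g gs (inSpan-zero gs)

inSpan-⊕ : ∀ {m} (gs : List (Vect m)) {a b} → inSpan gs a ≡ true → inSpan gs b ≡ true → inSpan gs (a ⊕ b) ≡ true
inSpan-⊕ []       {a} {b} a∈ b∈ = trans (inSpan-[] (a ⊕ b)) (==V-complete (begin
  a ⊕ b          ≡⟨ cong₂ _⊕_ (==V-sound (trans (sym (inSpan-[] a)) a∈)) (==V-sound (trans (sym (inSpan-[] b)) b∈)) ⟩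
  zeroV ⊕ zeroV  ≡⟨ ⊕-self zeroV ⟩
  zeroV          ∎))
inSpan-⊕ (g ∷ gs) {a} {b} a∈ b∈ with inSpan-∷⁻ g gs a∈ | inSpan-∷⁻ g gs b∈
... | inj₁ a∈gs  | inj₁ b∈gs  = inSpan-∷⁺ˡ g gs (inSpan-⊕ gs a∈gs b∈gs)
... | inj₁ a∈gs  | inj₂ gb∈gs = inSpan-∷⁺ʳ g gs (subst (λ x → inSpan gs x ≡ true) (swap-middle a g b) (inSpan-⊕ gs a∈gs gb∈gs))
  where
  swap-middle : ∀ a g b → a ⊕ (g ⊕ b) ≡ g ⊕ (a ⊕ b)
  swap-middle = ⊕-Properties.x∙yz≈y∙xz
... | inj₂ ga∈gs | inj₁ b∈gs  = inSpan-∷⁺ʳ g gs (subst (λ x → inSpan gs x ≡ true) (⊕-assoc g a b) (inSpan-⊕ gs ga∈gs b∈gs))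
... | inj₂ ga∈gs | inj₂ gb∈gs = inSpan-∷⁺ˡ g gs (subst (λ x → inSpan gs x ≡ true) (cancel-common g a b) (inSpan-⊕ gs ga∈gs gb∈gs))
  where
  cancel-common : ∀ g a b → (g ⊕ a) ⊕ (g ⊕ b) ≡ a ⊕ b
  cancel-common g a b = begin
    (g ⊕ a) ⊕ (g ⊕ b)  ≡⟨ ⊕-Properties.interchange g a g b ⟩
    (g ⊕ g) ⊕ (a ⊕ b)  ≡⟨ cong (_⊕ (a ⊕ b)) (⊕-self g) ⟩
    zeroV ⊕ (a ⊕ b)    ≡⟨ ⊕-identityˡ (a ⊕ b) ⟩
    a ⊕ b              ∎

inSpan-isSubspace : ∀ {m} (gs : List (Vect m)) → IsSubspace (inSpan gs)
inSpan-isSubspace gs = record { zero∈ = inSpan-zero gs ; ⊕-closed = inSpan-⊕ gs }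

inSpan-generator : ∀ {m} {g : Vect m} gs → g ∈ gs → inSpan gs g ≡ true
inSpan-generator (g ∷ gs) (here refl) =
  inSpan-∷⁺ʳ g gs (subst (λ x → inSpan gs x ≡ true) (sym (⊕-self g)) (inSpan-zero gs))
inSpan-generator (g ∷ gs) (there g′∈gs) = inSpan-∷⁺ˡ g gs (inSpan-generator gs g′∈gs)

inSpan-∷-redundant : ∀ {m} (g : Vect m) gs → inSpan gs g ≡ true → ∀ v → inSpan (g ∷ gs) v ≡ inSpan gs v
inSpan-∷-redundant g gs g∈ v = begin
  inSpan (g ∷ gs) v                ≡⟨ inSpan-∷ g gs v ⟩
  inSpan gs v ∨ inSpan gs (g ⊕ v)  ≡⟨ cong (inSpan gs v ∨_) (translate-member (inSpan-isSubspace gs) g∈ v) ⟩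
  inSpan gs v ∨ inSpan gs v        ≡⟨ Bool.∨-idem (inSpan gs v) ⟩
  inSpan gs v                      ∎

card-inSpan-∷-new : ∀ {m} (g : Vect m) gs → inSpan gs g ≡ false → card (inSpan (g ∷ gs)) ≡ 2 * card (inSpan gs)
card-inSpan-∷-new g gs g∉ =
  trans (card-cong (inSpan-∷ g gs)) (card-coset-union (inSpan-isSubspace gs) g∉)

card-inSpan-[] : ∀ m → card {m} (inSpan []) ≡ 1
card-inSpan-[] m = trans (card-cong {m} {inSpan []} inSpan-[]) (card-zeroV m)

card-inSpan-pow2 : ∀ {m} (gs : List (Vect m)) → ∃ λ r → card (inSpan gs) ≡ 2 ^ r
card-inSpan-pow2 {m} [] = 0 , card-inSpan-[] m
card-inSpan-pow2 (g ∷ gs) with card-inSpan-pow2 gs | inSpan gs g in g∈?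
... | r , card≡ | true  = r , trans (card-cong (inSpan-∷-redundant g gs g∈?)) card≡
... | r , card≡ | false = suc r , trans (card-inSpan-∷-new g gs g∈?) (cong (2 *_) card≡)

module _ {m} {P : Vect m → Bool} (S : IsSubspace P) where
  open IsSubspace S

  inSpan-⊆ : ∀ gs → (∀ {g} → g ∈ gs → P g ≡ true) → ∀ {v} → inSpan gs v ≡ true → P v ≡ true
  inSpan-⊆ []       _     {v} v∈ = subst (λ x → P x ≡ true) (sym (==V-sound (trans (sym (inSpan-[] v)) v∈))) zero∈
  inSpan-⊆ (g ∷ gs) gs⊆P {v} v∈ with inSpan-∷⁻ g gs v∈
  ... | inj₁ v∈gs  = inSpan-⊆ gs (gs⊆P ∘ there) v∈gs
  ... | inj₂ gv∈gs = subst (λ x → P x ≡ true) (⊕-cancelˡ g v)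
                       (⊕-closed (gs⊆P (here refl)) (inSpan-⊆ gs (gs⊆P ∘ there) gv∈gs))

  elements : List (Vect m)
  elements = filter (λ v → P v Bool.≟ true) (allVecs m)

  inSpan-elements : ∀ v → inSpan elements v ≡ P v
  inSpan-elements v = bool-ext
    (inSpan-⊆ elements (λ g∈ → proj₂ (∈-filter⁻ (λ v → P v Bool.≟ true) {xs = allVecs m} g∈)))
    (λ Pv → inSpan-generator elements (∈-filter⁺ (λ v → P v Bool.≟ true) (∈-allVecs v) Pv))

  card-subspace : card P ≡ 2 ^ dim P
  card-subspace = let r , card≡2^r = card-inSpan-pow2 elements
                      card-P≡2^r = trans (card-cong (sym ∘ inSpan-elements)) card≡2^r
                  in trans card-P≡2^r (cong (2 ^_) (sym (trans (cong ⌊log₂_⌋ card-P≡2^r) (⌊log₂[2^n]⌋≡n r))))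

-- Orthogonal complements

_·_ : ∀ {m} → Vect m → Vect m → Bool
[]      · []      = false
(a ∷ u) · (b ∷ w) = (a ∧ b) xor (u · w)

·-comm : ∀ {m} (u w : Vect m) → u · w ≡ w · u
·-comm []      []      = refl
·-comm (a ∷ u) (b ∷ w) = cong₂ _xor_ (Bool.∧-comm a b) (·-comm u w)

·-zeroˡ : ∀ {m} (w : Vect m) → zeroV · w ≡ false
·-zeroˡ []      = refl
·-zeroˡ (_ ∷ w) = ·-zeroˡ w

·-⊕ˡ : ∀ {m} (u v w : Vect m) → (u ⊕ v) · w ≡ (u · w) xor (v · w)
·-⊕ˡ []      []      []      = refl
·-⊕ˡ (a ∷ u) (c ∷ v) (b ∷ w) = begin
  ((a xor c) ∧ b) xor ((u ⊕ v) · w)              ≡⟨ cong₂ _xor_ (Bool.∧-distribʳ-xor b a c) (·-⊕ˡ u v w) ⟩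
  ((a ∧ b) xor (c ∧ b)) xor ((u · w) xor (v · w)) ≡⟨ xor-Properties.interchange (a ∧ b) (c ∧ b) (u · w) (v · w) ⟩
  ((a ∧ b) xor (u · w)) xor ((c ∧ b) xor (v · w)) ∎

even-suc : ∀ k → ((suc k % 2) ≡ᵇ 0) ≡ not ((k % 2) ≡ᵇ 0)
even-suc zero    = refl
even-suc (suc k) = trans (sym (Bool.not-involutive _)) (cong not (sym (even-suc k)))

orth≡not· : ∀ {m} (u w : Vect m) → orth u w ≡ not (u · w)
orth≡not· []          []          = refl
orth≡not· (true ∷ u)  (true ∷ w)  = trans (even-suc ∣ u ∩ w ∣) (cong not (orth≡not· u w))
orth≡not· (true ∷ u)  (false ∷ w) = orth≡not· u w
orth≡not· (false ∷ u) (true ∷ w)  = orth≡not· u w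
orth≡not· (false ∷ u) (false ∷ w) = orth≡not· u w

·≡not-orth : ∀ {m} (u w : Vect m) → u · w ≡ not (orth u w)
·≡not-orth u w = trans (sym (Bool.not-involutive (u · w))) (cong not (sym (orth≡not· u w)))

orth-comm : ∀ {m} (u w : Vect m) → orth u w ≡ orth w u
orth-comm u w = trans (orth≡not· u w) (trans (cong not (·-comm u w)) (sym (orth≡not· w u)))

orth-⊕ˡ : ∀ {m} (u v w : Vect m) → orth (u ⊕ v) w ≡ not ((u · w) xor (v · w))
orth-⊕ˡ u v w = trans (orth≡not· (u ⊕ v) w) (cong not (·-⊕ˡ u v w))

orth-translate-odd : ∀ {m} {c w : Vect m} → orth c w ≡ false → ∀ v → orth (v ⊕ c) w ≡ not (orth v w)
orth-translate-odd {c = c} {w} orth-c≡false v = begin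
  orth (v ⊕ c) w                ≡⟨ orth-⊕ˡ v c w ⟩
  not ((v · w) xor (c · w))     ≡⟨ cong (λ b → not ((v · w) xor b)) c·w≡true ⟩
  not ((v · w) xor true)        ≡⟨ cong not (Bool.xor-comm (v · w) true) ⟩
  not (not (v · w))             ≡⟨ cong not (orth≡not· v w) ⟨
  not (orth v w)                ∎
  where
  c·w≡true : c · w ≡ true
  c·w≡true = trans (·≡not-orth c w) (cong not orth-c≡false)

nonzero⇒odd-partner : ∀ {m} (w : Vect m) → (w ==V zeroV) ≡ false → ∃ λ c → orth c w ≡ false
nonzero⇒odd-partner []          []≢0 = case trans (sym (==V-complete {u = []} refl)) []≢0 of λ ()
nonzero⇒odd-partner (true ∷ w)  _    = (true ∷ zeroV) , trans (orth≡not· (true ∷ zeroV) (true ∷ w)) (cong not (cong not (·-zeroˡ w)))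
nonzero⇒odd-partner (false ∷ w) w≢0  =
  let c , odd = nonzero⇒odd-partner w (trans (sym (==V-zeroV-false∷ w)) w≢0) in (false ∷ c) , odd

inSpan⇒∈sums : ∀ {m} (gs : List (Vect m)) {w} → inSpan gs w ≡ true → w ∈ sums gs
inSpan⇒∈sums gs = any-==V⁻ (sums gs)

inPerp-orth : ∀ {m} (gs : List (Vect m)) {u w} → inPerp gs u ≡ true → inSpan gs w ≡ true → orth u w ≡ true
inPerp-orth gs {u} u⊥ w∈ = all-∈ (orth u) u⊥ (inSpan⇒∈sums gs w∈)

inPerp-witness : ∀ {m} (gs : List (Vect m)) {u} → inPerp gs u ≡ false → ∃ λ w → inSpan gs w ≡ true × orth u w ≡ false
inPerp-witness gs {u} u⊥̸ = let w , w∈ , odd = all-false⁻ (orth u) (sums gs) u⊥̸ in w , any-==V⁺ w∈ , odd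

inPerp-isSubspace : ∀ {m} (gs : List (Vect m)) → IsSubspace (inPerp gs)
inPerp-isSubspace gs = record
  { zero∈    = all-complete (orth zeroV) (sums gs) λ {w} _ →
                 trans (orth≡not· zeroV w) (cong not (·-zeroˡ w))
  ; ⊕-closed = λ {u} {v} u⊥ v⊥ → all-complete (orth (u ⊕ v)) (sums gs) λ {w} w∈ →
                 let u·w≡false = trans (·≡not-orth u w) (cong not (all-∈ (orth u) u⊥ w∈))
                     v·w≡false = trans (·≡not-orth v w) (cong not (all-∈ (orth v) v⊥ w∈))
                 in trans (orth-⊕ˡ u v w) (cong₂ (λ a b → not (a xor b)) u·w≡false v·w≡false)
  }

module _ {m} {P : Vect m → Bool} (S : IsSubspace P) where

  card-kernel-half : ∀ {v w₀} → P w₀ ≡ true → orth v w₀ ≡ false → 2 * card (λ w → P w ∧ orth v w) ≡ card P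
  card-kernel-half {v} {w₀} Pw₀ odd = begin
    2 * card kernel                                                   ≡⟨ cong (card kernel +_) (+-identityʳ (card kernel)) ⟩
    card kernel + card kernel                                         ≡⟨ cong (card kernel +_) (card-translate kernel w₀) ⟨
    card kernel + card (λ w → kernel (w ⊕ w₀))                        ≡⟨ cong (card kernel +_) (card-cong shifted) ⟩
    card kernel + card (λ w → P w ∧ not (orth v w))                   ≡⟨ card-split P (orth v) ⟨
    card P                                                            ∎
    where
    kernel : Vect m → Bool
    kernel w = P w ∧ orth v w
    shifted : ∀ w → kernel (w ⊕ w₀) ≡ P w ∧ not (orth v w)
    shifted w = cong₂ _∧_
      (trans (cong P (⊕-comm w w₀)) (translate-member S Pw₀ w))
      (trans (orth-comm v (w ⊕ w₀)) (trans (orth-translate-odd (trans (orth-comm w₀ v) odd) w) (cong not (orth-comm w v))))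

all-isSubspace : ∀ {m} → IsSubspace {m} (λ _ → true)
all-isSubspace = record { zero∈ = refl ; ⊕-closed = λ _ _ → refl }

2*m≡m*1+m*1 : ∀ k → 2 * k ≡ k * 1 + k * 1
2*m≡m*1+m*1 k = trans (cong (k +_) (+-identityʳ k)) (sym (cong₂ _+_ (*-identityʳ k) (*-identityʳ k)))

orth-count-row : ∀ {m} (gs : List (Vect m)) v →
  2 * card (λ w → inSpan gs w ∧ orth v w) ≡ card (inSpan gs) * toℕ (inPerp gs v) + card (inSpan gs) * 1
orth-count-row {m} gs v with inPerp gs v in v⊥?
... | true  = trans (cong (2 *_) (card-cong {m} orth-all)) (2*m≡m*1+m*1 (card (inSpan gs)))
  where
  orth-all : ∀ w → inSpan gs w ∧ orth v w ≡ inSpan gs w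
  orth-all w with inSpan gs w in w∈?
  ... | true  = inPerp-orth gs {v} {w} v⊥? w∈?
  ... | false = refl
... | false = let w₀ , w₀∈ , odd = inPerp-witness gs {v} v⊥? in
  trans (card-kernel-half (inSpan-isSubspace gs) {v} {w₀} w₀∈ odd)
        (sym (cong₂ _+_ (*-zeroʳ (card (inSpan gs))) (*-identityʳ (card (inSpan gs)))))

orth-count-column : ∀ {m} (gs : List (Vect m)) w →
  2 * card (λ v → inSpan gs w ∧ orth v w) ≡ 2 ^ m * toℕ (inSpan gs w) + 2 ^ m * toℕ (w ==V zeroV)
orth-count-column {m} gs w with inSpan gs w in w∈? | w ==V zeroV in w≡0?
... | false | true  = case trans (sym (subst (λ x → inSpan gs x ≡ true) (sym (==V-sound w≡0?)) (inSpan-zero gs))) w∈? of λ ()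
... | false | false = trans (cong (2 *_) (count-none (allVecs m))) (sym (cong₂ _+_ (*-zeroʳ (2 ^ m)) (*-zeroʳ (2 ^ m))))
... | true  | true  = trans (cong (2 *_) (trans (card-cong {m} orth-zero) (card-const-true m))) (2*m≡m*1+m*1 (2 ^ m))
  where
  orth-zero : ∀ v → true ∧ orth v w ≡ true
  orth-zero v = trans (orth≡not· v w) (cong not (trans (cong (v ·_) (==V-sound w≡0?)) (trans (·-comm v zeroV) (·-zeroˡ v))))
... | true  | false = let c , odd = nonzero⇒odd-partner w w≡0? in begin
  2 * card (λ v → true ∧ orth v w)   ≡⟨ cong (2 *_) (card-cong {m} (λ v → orth-comm v w)) ⟩
  2 * card (λ v → true ∧ orth w v)   ≡⟨ card-kernel-half all-isSubspace {w} {c} refl (trans (orth-comm w c) odd) ⟩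
  card {m} (λ _ → true)              ≡⟨ card-const-true m ⟩
  2 ^ m                              ≡⟨ +-identityʳ (2 ^ m) ⟨
  2 ^ m + 0                          ≡⟨ cong₂ _+_ (*-identityʳ (2 ^ m)) (*-zeroʳ (2 ^ m)) ⟨
  2 ^ m * 1 + 2 ^ m * 0              ∎

-- Count the pairs (v , w) with w in the span and v orthogonal to w by rows and by columns.
card-span*card-perp : ∀ {m} (gs : List (Vect m)) → card (inSpan gs) * card (inPerp gs) ≡ 2 ^ m
card-span*card-perp {m} gs = +-cancelʳ-≡ (S * 2 ^ m) (S * card (inPerp gs)) (2 ^ m) (begin
  S * card (inPerp gs) + S * 2 ^ m
    ≡⟨ cong (λ k → S * card (inPerp gs) + S * k) (card-const-true m) ⟨
  S * card (inPerp gs) + S * card {m} (λ _ → true)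
    ≡⟨ sum-indicators S S (inPerp gs) (λ _ → true) ⟨
  sum (map (λ v → S * toℕ (inPerp gs v) + S * 1) A)
    ≡⟨ sum-map-cong (orth-count-row gs) A ⟨
  sum (map (λ v → 2 * count (R v) A) A)
    ≡⟨ sum-map-*ˡ 2 (λ v → count (R v) A) A ⟩
  2 * sum (map (λ v → count (R v) A) A)
    ≡⟨ cong (2 *_) (count-swap R A A) ⟩
  2 * sum (map (λ w → count (λ v → R v w) A) A)
    ≡⟨ sum-map-*ˡ 2 (λ w → count (λ v → R v w) A) A ⟨
  sum (map (λ w → 2 * count (λ v → R v w) A) A)
    ≡⟨ sum-map-cong (orth-count-column gs) A ⟩
  sum (map (λ w → 2 ^ m * toℕ (inSpan gs w) + 2 ^ m * toℕ (w ==V zeroV)) A)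
    ≡⟨ sum-indicators (2 ^ m) (2 ^ m) (inSpan gs) (_==V zeroV) ⟩
  2 ^ m * S + 2 ^ m * card {m} (_==V zeroV)
    ≡⟨ cong₂ _+_ (*-comm (2 ^ m) S) (trans (cong (2 ^ m *_) (card-zeroV m)) (*-identityʳ (2 ^ m))) ⟩
  S * 2 ^ m + 2 ^ m
    ≡⟨ +-comm (S * 2 ^ m) (2 ^ m) ⟩
  2 ^ m + S * 2 ^ m  ∎)
  where
  A = allVecs m
  S = card (inSpan gs)
  R : Vect m → Vect m → Bool
  R v w = inSpan gs w ∧ orth v w

-- Dimensions

∧-isSubspace : ∀ {m} {P Q : Vect m → Bool} → IsSubspace P → IsSubspace Q → IsSubspace (λ v → P v ∧ Q v)
∧-isSubspace SP SQ = record
  { zero∈    = ∧-true⁺ (IsSubspace.zero∈ SP) (IsSubspace.zero∈ SQ)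
  ; ⊕-closed = λ Puv Quv →
      let Pu , Qu = ∧-true⁻ Puv ; Pv , Qv = ∧-true⁻ Quv
      in ∧-true⁺ (IsSubspace.⊕-closed SP Pu Pv) (IsSubspace.⊕-closed SQ Qu Qv)
  }

inSpan-++⁺ : ∀ {m} (as bs : List (Vect m)) {a b} → inSpan as a ≡ true → inSpan bs b ≡ true → inSpan (as ++ bs) (a ⊕ b) ≡ true
inSpan-++⁺ []       bs {a} {b} a∈ b∈ =
  subst (λ x → inSpan bs x ≡ true) (trans (sym (⊕-identityˡ b)) (cong (_⊕ b) (sym (==V-sound (trans (sym (inSpan-[] a)) a∈))))) b∈
inSpan-++⁺ (g ∷ as) bs {a} {b} a∈ b∈ with inSpan-∷⁻ g as a∈
... | inj₁ a∈as  = inSpan-∷⁺ˡ g (as ++ bs) (inSpan-++⁺ as bs a∈as b∈)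
... | inj₂ ga∈as = inSpan-∷⁺ʳ g (as ++ bs) (subst (λ x → inSpan (as ++ bs) x ≡ true) (⊕-assoc g a b) (inSpan-++⁺ as bs ga∈as b∈))

inSpan-++⁻ : ∀ {m} (as bs : List (Vect m)) {v} → inSpan (as ++ bs) v ≡ true →
  ∃ λ a → ∃ λ b → inSpan as a ≡ true × inSpan bs b ≡ true × a ⊕ b ≡ v
inSpan-++⁻ []       bs {v} v∈ = zeroV , v , inSpan-zero [] , v∈ , ⊕-identityˡ v
inSpan-++⁻ (g ∷ as) bs {v} v∈ with inSpan-∷⁻ g (as ++ bs) v∈
... | inj₁ v∈as++bs =
  let a , b , a∈ , b∈ , a⊕b≡v = inSpan-++⁻ as bs v∈as++bs in a , b , inSpan-∷⁺ˡ g as a∈ , b∈ , a⊕b≡v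
... | inj₂ gv∈as++bs =
  let a , b , a∈ , b∈ , a⊕b≡gv = inSpan-++⁻ as bs gv∈as++bs
  in g ⊕ a , b
   , inSpan-∷⁺ʳ g as (subst (λ x → inSpan as x ≡ true) (sym (⊕-cancelˡ g a)) a∈)
   , b∈
   , (begin
       (g ⊕ a) ⊕ b  ≡⟨ ⊕-assoc g a b ⟩
       g ⊕ (a ⊕ b)  ≡⟨ cong (g ⊕_) a⊕b≡gv ⟩
       g ⊕ (g ⊕ v)  ≡⟨ ⊕-cancelˡ g v ⟩
       v            ∎)

inSpan-++ˡ : ∀ {m} (as bs : List (Vect m)) {a} → inSpan as a ≡ true → inSpan (as ++ bs) a ≡ true
inSpan-++ˡ as bs {a} a∈ = subst (λ x → inSpan (as ++ bs) x ≡ true) (⊕-identityʳ a) (inSpan-++⁺ as bs a∈ (inSpan-zero bs))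

module _ {m} (g : Vect m) (as bs : List (Vect m)) where

  card-∩-∷-inside : ∀ {a b} → inSpan as a ≡ true → inSpan bs b ≡ true → a ⊕ b ≡ g → inSpan as g ≡ false →
    card (λ v → inSpan (g ∷ as) v ∧ inSpan bs v) ≡ 2 * card (λ v → inSpan as v ∧ inSpan bs v)
  card-∩-∷-inside {a} {b} a∈ b∈ a⊕b≡g g∉as = begin
    card (λ v → inSpan (g ∷ as) v ∧ inSpan bs v)  ≡⟨ card-cong {m} coset-form ⟩
    card (λ v → I v ∨ I (b ⊕ v))                   ≡⟨ card-coset-union I-isSubspace b∉I ⟩
    2 * card I                                     ∎
    where
    I : Vect m → Bool
    I v = inSpan as v ∧ inSpan bs v
    I-isSubspace = ∧-isSubspace (inSpan-isSubspace as) (inSpan-isSubspace bs)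
    b∉I : I b ≡ false
    b∉I = Bool.¬-not {y = true} λ b∈I → case trans (sym g∉as) (subst (λ x → inSpan as x ≡ true) a⊕b≡g
            (inSpan-⊕ as a∈ (proj₁ (∧-true⁻ b∈I)))) of λ ()
    coset-form : ∀ v → inSpan (g ∷ as) v ∧ inSpan bs v ≡ I v ∨ I (b ⊕ v)
    coset-form v = begin
      inSpan (g ∷ as) v ∧ inSpan bs v                          ≡⟨ cong (_∧ inSpan bs v) (inSpan-∷ g as v) ⟩
      (inSpan as v ∨ inSpan as (g ⊕ v)) ∧ inSpan bs v          ≡⟨ Bool.∧-distribʳ-∨ (inSpan bs v) (inSpan as v) _ ⟩
      I v ∨ (inSpan as (g ⊕ v) ∧ inSpan bs v)                  ≡⟨ cong (I v ∨_) (cong₂ _∧_ shift-A shift-B) ⟩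
      I v ∨ I (b ⊕ v)                                          ∎
      where
      shift-A : inSpan as (g ⊕ v) ≡ inSpan as (b ⊕ v)
      shift-A = begin
        inSpan as (g ⊕ v)        ≡⟨ cong (λ x → inSpan as (x ⊕ v)) a⊕b≡g ⟨
        inSpan as ((a ⊕ b) ⊕ v)  ≡⟨ cong (inSpan as) (⊕-assoc a b v) ⟩
        inSpan as (a ⊕ (b ⊕ v))  ≡⟨ translate-member (inSpan-isSubspace as) a∈ (b ⊕ v) ⟩
        inSpan as (b ⊕ v)        ∎
      shift-B : inSpan bs v ≡ inSpan bs (b ⊕ v)
      shift-B = sym (translate-member (inSpan-isSubspace bs) b∈ v)

  card-∩-∷-outside : inSpan (as ++ bs) g ≡ false →
    card (λ v → inSpan (g ∷ as) v ∧ inSpan bs v) ≡ card (λ v → inSpan as v ∧ inSpan bs v)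
  card-∩-∷-outside g∉as++bs = card-cong {m} λ v → begin
    inSpan (g ∷ as) v ∧ inSpan bs v                          ≡⟨ cong (_∧ inSpan bs v) (inSpan-∷ g as v) ⟩
    (inSpan as v ∨ inSpan as (g ⊕ v)) ∧ inSpan bs v          ≡⟨ Bool.∧-distribʳ-∨ (inSpan bs v) (inSpan as v) _ ⟩
    (inSpan as v ∧ inSpan bs v) ∨ (inSpan as (g ⊕ v) ∧ inSpan bs v)
      ≡⟨ cong ((inSpan as v ∧ inSpan bs v) ∨_) (no-shifted v) ⟩
    (inSpan as v ∧ inSpan bs v) ∨ false                      ≡⟨ Bool.∨-identityʳ _ ⟩
    inSpan as v ∧ inSpan bs v                                ∎
    where
    no-shifted : ∀ v → inSpan as (g ⊕ v) ∧ inSpan bs v ≡ false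
    no-shifted v = Bool.¬-not {y = true} λ both →
      let gv∈ , v∈ = ∧-true⁻ both
      in case trans (sym g∉as++bs) (subst (λ x → inSpan (as ++ bs) x ≡ true) (⊕-cancelʳ g v) (inSpan-++⁺ as bs gv∈ v∈)) of λ ()

card-sum*card-∩-∷-new : ∀ {m} (g : Vect m) as bs → inSpan as g ≡ false →
  card (inSpan (g ∷ as ++ bs)) * card (λ v → inSpan (g ∷ as) v ∧ inSpan bs v)
    ≡ 2 * (card (inSpan (as ++ bs)) * card (λ v → inSpan as v ∧ inSpan bs v))
card-sum*card-∩-∷-new g as bs g∉as with inSpan (as ++ bs) g in g∈as++bs?
... | true = let a , b , a∈ , b∈ , a⊕b≡g = inSpan-++⁻ as bs g∈as++bs? in begin
  card (inSpan (g ∷ as ++ bs)) * card (λ v → inSpan (g ∷ as) v ∧ inSpan bs v)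
    ≡⟨ cong₂ _*_ (card-cong (inSpan-∷-redundant g (as ++ bs) g∈as++bs?)) (card-∩-∷-inside g as bs a∈ b∈ a⊕b≡g g∉as) ⟩
  card (inSpan (as ++ bs)) * (2 * card (λ v → inSpan as v ∧ inSpan bs v))
    ≡⟨ ℕ-*.x∙yz≈y∙xz (card (inSpan (as ++ bs))) 2 _ ⟩
  2 * (card (inSpan (as ++ bs)) * card (λ v → inSpan as v ∧ inSpan bs v))  ∎
... | false = begin
  card (inSpan (g ∷ as ++ bs)) * card (λ v → inSpan (g ∷ as) v ∧ inSpan bs v)
    ≡⟨ cong₂ _*_ (card-inSpan-∷-new g (as ++ bs) g∈as++bs?) (card-∩-∷-outside g as bs g∈as++bs?) ⟩
  2 * card (inSpan (as ++ bs)) * card (λ v → inSpan as v ∧ inSpan bs v)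
    ≡⟨ *-assoc 2 (card (inSpan (as ++ bs))) _ ⟩
  2 * (card (inSpan (as ++ bs)) * card (λ v → inSpan as v ∧ inSpan bs v))  ∎

card-sum*card-∩ : ∀ {m} (as bs : List (Vect m)) →
  card (inSpan (as ++ bs)) * card (λ v → inSpan as v ∧ inSpan bs v) ≡ card (inSpan as) * card (inSpan bs)
card-sum*card-∩ {m} [] bs = begin
  card (inSpan bs) * card (λ v → inSpan [] v ∧ inSpan bs v)  ≡⟨ cong (card (inSpan bs) *_) (trans (card-cong {m} only-zero) (card-inSpan-[] m)) ⟩
  card (inSpan bs) * 1                                       ≡⟨ *-comm (card (inSpan bs)) 1 ⟩
  1 * card (inSpan bs)                                       ≡⟨ cong (_* card (inSpan bs)) (card-inSpan-[] m) ⟨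
  card {m} (inSpan []) * card (inSpan bs)                    ∎
  where
  only-zero : ∀ v → inSpan [] v ∧ inSpan bs v ≡ inSpan [] v
  only-zero v with inSpan [] v in v∈[]
  ... | true  = subst (λ x → inSpan bs x ≡ true) (sym (==V-sound (trans (sym (inSpan-[] v)) v∈[]))) (inSpan-zero bs)
  ... | false = refl
card-sum*card-∩ (g ∷ as) bs with inSpan as g in g∈as?
... | true = begin
  card (inSpan (g ∷ as ++ bs)) * card (λ v → inSpan (g ∷ as) v ∧ inSpan bs v)
    ≡⟨ cong₂ _*_ (card-cong (inSpan-∷-redundant g (as ++ bs) (inSpan-++ˡ as bs g∈as?)))
                 (card-cong (λ v → cong (_∧ inSpan bs v) (inSpan-∷-redundant g as g∈as? v))) ⟩
  card (inSpan (as ++ bs)) * card (λ v → inSpan as v ∧ inSpan bs v)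
    ≡⟨ card-sum*card-∩ as bs ⟩
  card (inSpan as) * card (inSpan bs)
    ≡⟨ cong (_* card (inSpan bs)) (card-cong (inSpan-∷-redundant g as g∈as?)) ⟨
  card (inSpan (g ∷ as)) * card (inSpan bs)  ∎
... | false = begin
  card (inSpan (g ∷ as ++ bs)) * card (λ v → inSpan (g ∷ as) v ∧ inSpan bs v)
    ≡⟨ card-sum*card-∩-∷-new g as bs g∈as? ⟩
  2 * (card (inSpan (as ++ bs)) * card (λ v → inSpan as v ∧ inSpan bs v))
    ≡⟨ cong (2 *_) (card-sum*card-∩ as bs) ⟩
  2 * (card (inSpan as) * card (inSpan bs))
    ≡⟨ *-assoc 2 (card (inSpan as)) _ ⟨
  2 * card (inSpan as) * card (inSpan bs)
    ≡⟨ cong (_* card (inSpan bs)) (card-inSpan-∷-new g as g∈as?) ⟨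
  card (inSpan (g ∷ as)) * card (inSpan bs)  ∎

2^-injective : ∀ {a b} → 2 ^ a ≡ 2 ^ b → a ≡ b
2^-injective {a} {b} 2^a≡2^b = begin
  a                ≡⟨ ⌊log₂[2^n]⌋≡n a ⟨
  ⌊log₂ 2 ^ a ⌋    ≡⟨ cong ⌊log₂_⌋ 2^a≡2^b ⟩
  ⌊log₂ 2 ^ b ⌋    ≡⟨ ⌊log₂[2^n]⌋≡n b ⟩
  b                ∎

card*card-subspaces : ∀ {m} {P Q : Vect m → Bool} → IsSubspace P → IsSubspace Q →
  card P * card Q ≡ 2 ^ (dim P + dim Q)
card*card-subspaces {P = P} {Q} SP SQ = trans (cong₂ _*_ (card-subspace SP) (card-subspace SQ)) (sym (^-distribˡ-+-* 2 (dim P) (dim Q)))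

dim-span+dim-perp : ∀ {m} (gs : List (Vect m)) → dim (inSpan gs) + dim (inPerp gs) ≡ m
dim-span+dim-perp gs = 2^-injective (trans
  (sym (card*card-subspaces (inSpan-isSubspace gs) (inPerp-isSubspace gs)))
  (card-span*card-perp gs))

dim-sum+dim-∩ : ∀ {m} (as bs : List (Vect m)) →
  dim (inSpan (as ++ bs)) + dim (λ v → inSpan as v ∧ inSpan bs v) ≡ dim (inSpan as) + dim (inSpan bs)
dim-sum+dim-∩ as bs = 2^-injective (begin
  2 ^ (dim (inSpan (as ++ bs)) + dim (λ v → inSpan as v ∧ inSpan bs v))
    ≡⟨ card*card-subspaces (inSpan-isSubspace (as ++ bs)) (∧-isSubspace (inSpan-isSubspace as) (inSpan-isSubspace bs)) ⟨
  card (inSpan (as ++ bs)) * card (λ v → inSpan as v ∧ inSpan bs v)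
    ≡⟨ card-sum*card-∩ as bs ⟩
  card (inSpan as) * card (inSpan bs)
    ≡⟨ card*card-subspaces (inSpan-isSubspace as) (inSpan-isSubspace bs) ⟩
  2 ^ (dim (inSpan as) + dim (inSpan bs))  ∎)

dim-cong : ∀ {m} {P Q : Vect m → Bool} → (∀ v → P v ≡ Q v) → dim P ≡ dim Q
dim-cong P≗Q = cong ⌊log₂_⌋ (card-cong P≗Q)

∸-pad : ∀ p i s c {m t} → p + i ≡ m → s + c ≡ t → p ∸ s ≡ (m + c) ∸ (i + t)
∸-pad p i s c refl refl = begin
  p ∸ s                          ≡⟨ [m+n]∸[m+o]≡n∸o (i + c) p s ⟨
  (i + c + p) ∸ (i + c + s)      ≡⟨ cong₂ _∸_ (ℕ-+.xy∙z≈zx∙y i c p) (ℕ-+.xy∙z≈x∙zy i c s) ⟩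
  (p + i + c) ∸ (i + (s + c))    ∎

cdef-formula : ∀ {m} (Li Lj Lk : List (Vect m)) →
  dim (inPerp Li) ∸ dim (inSpan (Lj ++ Lk))
    ≡ (m + dim (λ v → inSpan Lj v ∧ inSpan Lk v)) ∸ (dim (inSpan Li) + (dim (inSpan Lj) + dim (inSpan Lk)))
cdef-formula Li Lj Lk =
  ∸-pad (dim (inPerp Li)) (dim (inSpan Li)) (dim (inSpan (Lj ++ Lk))) (dim (λ v → inSpan Lj v ∧ inSpan Lk v))
          (trans (+-comm (dim (inPerp Li)) _) (dim-span+dim-perp Li)) (dim-sum+dim-∩ Lj Lk)

-- Orbits of involutions

module Orbits {n} (generators : List (Fin n → Fin n)) (involutive : ∀ {g} → g ∈ generators → ∀ x → g (g x) ≡ x) where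

  data Walk : ℕ → Fin n → Fin n → Set where
    stop : ∀ {k x} → Walk k x x
    step : ∀ {k x y g} → g ∈ generators → Walk k (g x) y → Walk (suc k) x y

  Walk-weaken : ∀ {k x y} → Walk k x y → Walk (suc k) x y
  Walk-weaken stop        = stop
  Walk-weaken (step g∈ w) = step g∈ (Walk-weaken w)

  Walk-snoc : ∀ {k x y g} → Walk k x y → g ∈ generators → Walk (suc k) x (g y)
  Walk-snoc stop        g∈ = step g∈ stop
  Walk-snoc (step h∈ w) g∈ = step h∈ (Walk-snoc w g∈)

  Walk-unsnoc : ∀ {k x y} → Walk (suc k) x y → Walk k x y ⊎ ∃ λ g → g ∈ generators × Walk k x (g y)
  Walk-unsnoc stop = inj₁ stop
  Walk-unsnoc {zero} {x} (step {g = g} g∈ stop) = inj₂ (g , g∈ , subst (Walk 0 x) (sym (involutive g∈ x)) stop)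
  Walk-unsnoc {suc k} (step g∈ w) with Walk-unsnoc w
  ... | inj₁ w′             = inj₁ (step g∈ w′)
  ... | inj₂ (h , h∈ , w′)  = inj₂ (h , h∈ , step g∈ w′)

  within-complete : ∀ {k x y} → Walk k x y → within generators k x y ≡ true
  within-complete {zero}  {x} stop = ⌊⌋-complete (x Fin.≟ x) refl
  within-complete {suc k}     stop = ∨-trueˡ _ (within-complete {k} stop)
  within-complete {suc k} {x} {y} (step g∈ w) =
    ∨-trueʳ (within generators k x y) (any-∈ (λ g → within generators k (g x) y) g∈ (within-complete w))

  within-sound : ∀ k x y → within generators k x y ≡ true → Walk k x y
  within-sound zero    x y h = subst (Walk 0 x) (⌊⌋-sound (x Fin.≟ y) h) stop
  within-sound (suc k) x y h with ∨-true⁻ {within generators k x y} h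
  ... | inj₁ short = Walk-weaken (within-sound k x y short)
  ... | inj₂ long  = let g , g∈ , rest = any-∃ (λ g → within generators k (g x) y) generators long
                     in step g∈ (within-sound k (g x) y rest)

  module _ (x : Fin n) where

    Stable : ℕ → Set
    Stable k = ∀ {y} → Walk (suc k) x y → Walk k x y

    stable-suc : ∀ {k} → Stable k → Stable (suc k)
    stable-suc {k} stable w with Walk-unsnoc w
    ... | inj₁ w′            = w′
    ... | inj₂ (g , g∈ , w′) = subst (Walk (suc k) x) (involutive g∈ _) (Walk-snoc (stable w′) g∈)

    stable-or-new : ∀ k → Stable k ⊎ ∃ λ y → within generators (suc k) x y ≡ true × within generators k x y ≡ false
    stable-or-new k with all (λ y → not (within generators (suc k) x y) ∨ within generators k x y) (allFin n) in check
    ... | true  = inj₁ λ {y} w → within-sound k x y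
                    (implies (within-complete w) (all-∈ _ check (∈-allFin y)))
      where
      implies : ∀ {a b} → a ≡ true → not a ∨ b ≡ true → b ≡ true
      implies refl b = b
    ... | false = let y , _ , new = all-false⁻ _ (allFin n) check in inj₂ (y , split new)
      where
      split : ∀ {a b} → not a ∨ b ≡ false → a ≡ true × b ≡ false
      split {true} {false} _ = refl , refl

    reached : ℕ → ℕ
    reached k = count (within generators k x) (allFin n)

    reached-≤ : ∀ k → reached k ≤ n
    reached-≤ k = subst (reached k ≤_) (Listₚ.length-tabulate id) (Listₚ.length-filter _ (allFin n))

    reached-grows : ∀ {k y} → within generators (suc k) x y ≡ true → within generators k x y ≡ false → suc (reached k) ≤ reached (suc k)
    reached-grows {k} {y} new old =
      subst (suc (reached k) ≤_) (sym reached-split) (m<m+n (reached k) (count-pos (∈-allFin y) (∧-true⁺ new (cong not old))))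
      where
      W W′ : Fin n → Bool
      W  = within generators k x
      W′ = within generators (suc k) x
      old⇒new : ∀ z → W′ z ∧ W z ≡ W z
      old⇒new z with W z
      ... | true  = refl
      ... | false = Bool.∧-zeroʳ _
      reached-split : reached (suc k) ≡ reached k + count (λ z → W′ z ∧ not (W z)) (allFin n)
      reached-split = trans (count-split W′ W (allFin n)) (cong (_+ count (λ z → W′ z ∧ not (W z)) (allFin n)) (count-cong old⇒new (allFin n)))

    -- Until reachability stabilises every step reaches a new flag, so it has stabilised after n steps.
    stable-or-large : ∀ k → Stable k ⊎ suc k ≤ reached k
    stable-or-large zero = inj₂ (count-pos (∈-allFin x) (within-complete {0} stop))
    stable-or-large (suc k) with stable-or-new k | stable-or-large k
    ... | inj₁ stable          | _           = inj₁ (stable-suc stable)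
    ... | inj₂ _               | inj₁ stable = inj₁ (stable-suc stable)
    ... | inj₂ (_ , new , old) | inj₂ large  = inj₂ (≤-trans (s≤s large) (reached-grows {k} new old))

    stable : Stable n
    stable with stable-or-large n
    ... | inj₁ s     = s
    ... | inj₂ large = ⊥-elim (<⇒≱ large (reached-≤ n))

  Invariant : (Fin n → Bool) → Set
  Invariant f = ∀ {g} → g ∈ generators → ∀ y → f (g y) ≡ f y

  sameOrbit-refl : ∀ x → sameOrbit generators x x ≡ true
  sameOrbit-refl x = within-complete {n} stop

  sameOrbit-invariant : ∀ x → Invariant (sameOrbit generators x)
  sameOrbit-invariant x {g} g∈ y = bool-ext
    (λ h → subst (λ z → sameOrbit generators x z ≡ true) (involutive g∈ y) (closed (g y) h))
    (closed y)
    where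
    closed : ∀ z → sameOrbit generators x z ≡ true → sameOrbit generators x (g z) ≡ true
    closed z h = within-complete (stable x (Walk-snoc (within-sound n x z h) g∈))

  invariant-on-orbit : ∀ {f} → Invariant f → ∀ {x y} → sameOrbit generators x y ≡ true → f x ≡ f y
  invariant-on-orbit {f} inv {x} {y} h = along (within-sound n x y h)
    where
    along : ∀ {k x y} → Walk k x y → f x ≡ f y
    along stop        = refl
    along (step g∈ w) = trans (sym (inv g∈ _)) (along w)

-- Flags, edges and cells

count-allFin-≟ : ∀ {n} (a : Fin n) → count (λ y → ⌊ y Fin.≟ a ⌋) (allFin n) ≡ 1
count-allFin-≟ {suc n} a = begin
  count (λ y → ⌊ y Fin.≟ a ⌋) (zero ∷ tabulate suc)       ≡⟨ cong (count (λ y → ⌊ y Fin.≟ a ⌋) ∘ (zero ∷_)) (Listₚ.map-tabulate id suc) ⟨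
  count (λ y → ⌊ y Fin.≟ a ⌋) (zero ∷ map suc (allFin n))      ≡⟨ count-∷ (λ y → ⌊ y Fin.≟ a ⌋) zero _ ⟩
  toℕ ⌊ zero Fin.≟ a ⌋ + count (λ y → ⌊ y Fin.≟ a ⌋) (map suc (allFin n))
    ≡⟨ cong (toℕ ⌊ zero Fin.≟ a ⌋ +_) (count-map (λ y → ⌊ y Fin.≟ a ⌋) suc (allFin n)) ⟩
  toℕ ⌊ zero Fin.≟ a ⌋ + count (λ y → ⌊ suc y Fin.≟ a ⌋) (allFin n)
    ≡⟨ at a ⟩
  1  ∎
  where
  at : ∀ a → toℕ ⌊ zero Fin.≟ a ⌋ + count (λ y → ⌊ suc y Fin.≟ a ⌋) (allFin n) ≡ 1
  at zero    = cong suc (count-none (allFin n))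
  at (suc a) = trans (count-cong (λ y → ⌊suc≟suc⌋ y a) (allFin n)) (count-allFin-≟ a)
    where
    ⌊suc≟suc⌋ : ∀ y a → ⌊ suc y Fin.≟ suc a ⌋ ≡ ⌊ y Fin.≟ a ⌋
    ⌊suc≟suc⌋ y a with y Fin.≟ a
    ... | yes _ = refl
    ... | no  _ = refl

count-allFin-single : ∀ {n} (Q : Fin n → Bool) (a : Fin n) → count (λ y → ⌊ y Fin.≟ a ⌋ ∧ Q y) (allFin n) ≡ toℕ (Q a)
count-allFin-single {n} Q a with Q a in Qa
... | true  = trans (count-cong at-a (allFin n)) (count-allFin-≟ a)
  where
  at-a : ∀ y → ⌊ y Fin.≟ a ⌋ ∧ Q y ≡ ⌊ y Fin.≟ a ⌋
  at-a y with y Fin.≟ a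
  ... | yes refl = Qa
  ... | no  _    = refl
... | false = trans (count-cong off-a (allFin n)) (count-none (allFin n))
  where
  off-a : ∀ y → ⌊ y Fin.≟ a ⌋ ∧ Q y ≡ false
  off-a y with y Fin.≟ a
  ... | yes refl = Qa
  ... | no  _    = refl

_∈ᵇ_ : ∀ {n} → Fin n → List (Fin n) → Bool
y ∈ᵇ as = any (λ a → ⌊ y Fin.≟ a ⌋) as

count-allFin-members : ∀ {n} (Q : Fin n → Bool) {as} → Unique as → count (λ y → y ∈ᵇ as ∧ Q y) (allFin n) ≡ count Q as
count-allFin-members {n} Q {[]}     []                = count-none (allFin n)
count-allFin-members {n} Q {a ∷ as} (a∉as ∷ as-unique) = begin
  count (λ y → (⌊ y Fin.≟ a ⌋ ∨ y ∈ᵇ as) ∧ Q y) (allFin n)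
    ≡⟨ count-cong (λ y → Bool.∧-distribʳ-∨ (Q y) ⌊ y Fin.≟ a ⌋ (y ∈ᵇ as)) (allFin n) ⟩
  count (λ y → (⌊ y Fin.≟ a ⌋ ∧ Q y) ∨ (y ∈ᵇ as ∧ Q y)) (allFin n)
    ≡⟨ count-∨-disjoint (λ y → ⌊ y Fin.≟ a ⌋ ∧ Q y) (λ y → y ∈ᵇ as ∧ Q y) disjoint (allFin n) ⟩
  count (λ y → ⌊ y Fin.≟ a ⌋ ∧ Q y) (allFin n) + count (λ y → y ∈ᵇ as ∧ Q y) (allFin n)
    ≡⟨ cong₂ _+_ (count-allFin-single Q a) (count-allFin-members Q as-unique) ⟩
  toℕ (Q a) + count Q as
    ≡⟨ count-∷ Q a as ⟨
  count Q (a ∷ as)  ∎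
  where
  disjoint : ∀ y → (⌊ y Fin.≟ a ⌋ ∧ Q y) ∧ (y ∈ᵇ as ∧ Q y) ≡ false
  disjoint y = Bool.¬-not {y = true} λ both →
    let y≡a = ⌊⌋-sound (y Fin.≟ a) (proj₁ (∧-true⁻ (proj₁ (∧-true⁻ both))))
        b , b∈as , y≡b = any-∃ (λ b → ⌊ y Fin.≟ b ⌋) as (proj₁ (∧-true⁻ (proj₂ (∧-true⁻ {⌊ y Fin.≟ a ⌋ ∧ Q y} both))))
    in All.lookup a∉as b∈as (trans (sym y≡a) (⌊⌋-sound (y Fin.≟ b) y≡b))

-- The flags of an edge are x, cross x, stay x and cross (stay x); stay keeps the cell (vertex, face
-- or zigzag) of a flag, cross passes to the cell on the other side of the edge.
record Crossing {n m} (M : Map n m) : Set where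
  field
    cross stay       : Fin n → Fin n
    cross-involutive : ∀ x → cross (cross x) ≡ x
    stay-involutive  : ∀ x → stay (stay x) ≡ x
    cross-stay-comm  : ∀ x → cross (stay x) ≡ stay (cross x)
    cross-fpf        : ∀ x → cross x ≢ x
    stay-fpf         : ∀ x → stay x ≢ x
    cross-stay-fpf   : ∀ x → cross (stay x) ≢ x
    edgeOf-cross     : ∀ x → Map.edgeOf M (cross x) ≡ Map.edgeOf M x
    edgeOf-stay      : ∀ x → Map.edgeOf M (stay x) ≡ Map.edgeOf M x
    edge-flags       : ∀ x y → Map.edgeOf M x ≡ Map.edgeOf M y →
                       y ≡ x ⊎ y ≡ cross x ⊎ y ≡ stay x ⊎ y ≡ cross (stay x)

module EdgeDifference {n m} {M : Map n m} (C : Crossing M) where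
  open Map M using (edgeOf; edgeOf-onto)
  open Crossing C

  flagOf : Fin m → Fin n
  flagOf e = proj₁ (edgeOf-onto e)

  edgeOf-flagOf : ∀ e → edgeOf (flagOf e) ≡ e
  edgeOf-flagOf e = proj₂ (edgeOf-onto e)

  -- δ f reads f at an arbitrary flag of each edge; by δ-lookup the choice is irrelevant for stay-invariant f.
  δ : (Fin n → Bool) → Vect m
  δ f = Vec.tabulate λ e → f (flagOf e) xor f (cross (flagOf e))

  δ-cong : ∀ {f g} → (∀ x → f x ≡ g x) → δ f ≡ δ g
  δ-cong f≗g = Vecₚ.tabulate-cong λ e → cong₂ _xor_ (f≗g _) (f≗g _)

  δ-xor : ∀ f g → δ (λ x → f x xor g x) ≡ δ f ⊕ δ g
  δ-xor f g = trans (Vecₚ.tabulate-cong λ e → xor-Properties.interchange (f (flagOf e)) (g (flagOf e)) _ _)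
                    (tabulate-xor _ _)

  StayInvariant : (Fin n → Bool) → Set
  StayInvariant f = ∀ x → f (stay x) ≡ f x

  δ-lookup : ∀ {f} → StayInvariant f → ∀ x → lookup (δ f) (edgeOf x) ≡ f x xor f (cross x)
  δ-lookup {f} inv x = trans (Vecₚ.lookup∘tabulate _ (edgeOf x)) (sym (same-edge (edge-flags a x (edgeOf-flagOf (edgeOf x)))))
    where
    a = flagOf (edgeOf x)
    same-edge : ∀ {a y} → y ≡ a ⊎ y ≡ cross a ⊎ y ≡ stay a ⊎ y ≡ cross (stay a) → f y xor f (cross y) ≡ f a xor f (cross a)
    same-edge (inj₁ refl) = refl
    same-edge {a} (inj₂ (inj₁ refl)) = trans (cong (f (cross a) xor_) (cong f (cross-involutive a))) (Bool.xor-comm (f (cross a)) (f a))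
    same-edge {a} (inj₂ (inj₂ (inj₁ refl))) = cong₂ _xor_ (inv a) (trans (cong f (cross-stay-comm a)) (inv (cross a)))
    same-edge {a} (inj₂ (inj₂ (inj₂ refl))) = begin
      f (cross (stay a)) xor f (cross (cross (stay a)))  ≡⟨ cong₂ (λ p q → f p xor f q) (cross-stay-comm a) (cross-involutive (stay a)) ⟩
      f (stay (cross a)) xor f (stay a)                  ≡⟨ cong₂ _xor_ (inv (cross a)) (inv a) ⟩
      f (cross a) xor f a                                ≡⟨ Bool.xor-comm (f (cross a)) (f a) ⟩
      f a xor f (cross a)                                ∎

  δ≡⇒cross-rule : ∀ {f X} → StayInvariant f → δ f ≡ X → ∀ x → f (cross x) ≡ f x xor lookup X (edgeOf x)
  δ≡⇒cross-rule {f} {X} inv δf≡X x = begin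
    f (cross x)                                   ≡⟨ xor-cancelˡ (f x) (f (cross x)) ⟨
    f x xor (f x xor f (cross x))                 ≡⟨ cong (f x xor_) (δ-lookup inv x) ⟨
    f x xor lookup (δ f) (edgeOf x)               ≡⟨ cong (λ v → f x xor lookup v (edgeOf x)) δf≡X ⟩
    f x xor lookup X (edgeOf x)                   ∎

  cross-rule⇒δ≡ : ∀ {f X} → (∀ x → f (cross x) ≡ f x xor lookup X (edgeOf x)) → δ f ≡ X
  cross-rule⇒δ≡ {f} {X} rule = trans (Vecₚ.tabulate-cong at) (Vecₚ.tabulate∘lookup X)
    where
    at : ∀ e → f (flagOf e) xor f (cross (flagOf e)) ≡ lookup X e
    at e = begin
      f (flagOf e) xor f (cross (flagOf e))                       ≡⟨ cong (f (flagOf e) xor_) (rule (flagOf e)) ⟩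
      f (flagOf e) xor (f (flagOf e) xor lookup X (edgeOf (flagOf e))) ≡⟨ xor-cancelˡ (f (flagOf e)) _ ⟩
      lookup X (edgeOf (flagOf e))                                ≡⟨ cong (lookup X) (edgeOf-flagOf e) ⟩
      lookup X e                                                  ∎

  fibre : Fin m → List (Fin n)
  fibre e = a ∷ cross a ∷ stay a ∷ cross (stay a) ∷ []
    where a = flagOf e

  fibre-unique : ∀ e → Unique (fibre e)
  fibre-unique e =
      (a≢ (cross-fpf a) ∷ a≢ (stay-fpf a) ∷ a≢ (cross-stay-fpf a) ∷ [])
    ∷ ((λ h → cross-stay-fpf a (trans (cong cross (sym h)) (cross-involutive a)))
       ∷ (λ h → stay-fpf a (sym (trans (sym (cross-involutive a)) (trans (cong cross h) (cross-involutive (stay a))))))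
       ∷ [])
    ∷ ((λ h → cross-fpf (stay a) (sym h)) ∷ [])
    ∷ []
    ∷ []
    where
    a = flagOf e
    a≢ : ∀ {b} → b ≢ a → a ≢ b
    a≢ b≢a a≡b = b≢a (sym a≡b)

  ∈ᵇ-fibre : ∀ e y → ⌊ edgeOf y Fin.≟ e ⌋ ≡ y ∈ᵇ fibre e
  ∈ᵇ-fibre e y = bool-ext (λ h → listed (edge-flags a y (trans (edgeOf-flagOf e) (sym (⌊⌋-sound (edgeOf y Fin.≟ e) h)))))
                          (λ h → let b , b∈ , y≡b = any-∃ (λ b → ⌊ y Fin.≟ b ⌋) (fibre e) h
                                 in ⌊⌋-complete (edgeOf y Fin.≟ e) (trans (cong edgeOf (⌊⌋-sound (y Fin.≟ b) y≡b)) (on-edge b∈)))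
    where
    a = flagOf e
    member : ∀ {b} → b ∈ fibre e → y ≡ b → y ∈ᵇ fibre e ≡ true
    member b∈ y≡b = any-∈ (λ b → ⌊ y Fin.≟ b ⌋) b∈ (⌊⌋-complete (y Fin.≟ _) y≡b)
    listed : y ≡ a ⊎ y ≡ cross a ⊎ y ≡ stay a ⊎ y ≡ cross (stay a) → y ∈ᵇ fibre e ≡ true
    listed (inj₁ y≡)                 = member (here refl) y≡
    listed (inj₂ (inj₁ y≡))          = member (there (here refl)) y≡
    listed (inj₂ (inj₂ (inj₁ y≡)))   = member (there (there (here refl))) y≡
    listed (inj₂ (inj₂ (inj₂ y≡)))   = member (there (there (there (here refl)))) y≡
    on-edge : ∀ {b} → b ∈ fibre e → edgeOf b ≡ e
    on-edge (here refl)                         = edgeOf-flagOf e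
    on-edge (there (here refl))                 = trans (edgeOf-cross a) (edgeOf-flagOf e)
    on-edge (there (there (here refl)))         = trans (edgeOf-stay a) (edgeOf-flagOf e)
    on-edge (there (there (there (here refl)))) = trans (edgeOf-cross (stay a)) (trans (edgeOf-stay a) (edgeOf-flagOf e))

  traversal-parity : ∀ {Q} → StayInvariant Q → ∀ e →
    ((count (λ y → ⌊ edgeOf y Fin.≟ e ⌋ ∧ Q y) (allFin n) / 2) % 2 ≡ᵇ 1) ≡ Q (flagOf e) xor Q (cross (flagOf e))
  traversal-parity {Q} inv e = begin
    (count (λ y → ⌊ edgeOf y Fin.≟ e ⌋ ∧ Q y) (allFin n) / 2) % 2 ≡ᵇ 1
      ≡⟨ cong (λ k → (k / 2) % 2 ≡ᵇ 1) fibre-count ⟩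
    ((toℕ (Q a) + (toℕ (Q (cross a)) + (toℕ (Q a) + (toℕ (Q (cross a)) + 0)))) / 2) % 2 ≡ᵇ 1
      ≡⟨ parity (Q a) (Q (cross a)) ⟩
    Q a xor Q (cross a)  ∎
    where
    a = flagOf e
    fibre-count : count (λ y → ⌊ edgeOf y Fin.≟ e ⌋ ∧ Q y) (allFin n) ≡ toℕ (Q a) + (toℕ (Q (cross a)) + (toℕ (Q a) + (toℕ (Q (cross a)) + 0)))
    fibre-count = begin
      count (λ y → ⌊ edgeOf y Fin.≟ e ⌋ ∧ Q y) (allFin n)  ≡⟨ count-cong (λ y → cong (_∧ Q y) (∈ᵇ-fibre e y)) (allFin n) ⟩
      count (λ y → y ∈ᵇ fibre e ∧ Q y) (allFin n)          ≡⟨ count-allFin-members Q (fibre-unique e) ⟩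
      count Q (fibre e)                                    ≡⟨ count≡sum Q (fibre e) ⟩
      toℕ (Q a) + (toℕ (Q (cross a)) + (toℕ (Q (stay a)) + (toℕ (Q (cross (stay a))) + 0)))
        ≡⟨ cong₂ (λ p q → toℕ (Q a) + (toℕ (Q (cross a)) + (toℕ p + (toℕ q + 0))))
                 (inv a) (trans (cong Q (cross-stay-comm a)) (inv (cross a))) ⟩
      toℕ (Q a) + (toℕ (Q (cross a)) + (toℕ (Q a) + (toℕ (Q (cross a)) + 0)))  ∎
    parity : ∀ p q → (((toℕ p + (toℕ q + (toℕ p + (toℕ q + 0)))) / 2) % 2 ≡ᵇ 1) ≡ p xor q
    parity false false = refl
    parity false true  = refl
    parity true  false = refl
    parity true  true  = refl

  any-boundary-flag : ∀ {Q} → StayInvariant Q → ∀ e →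
    any (λ y → ⌊ edgeOf y Fin.≟ e ⌋ ∧ Q y ∧ not (Q (cross y))) (allFin n) ≡ Q (flagOf e) xor Q (cross (flagOf e))
  any-boundary-flag {Q} inv e = bool-ext found witness
    where
    a = flagOf e
    P : Fin n → Bool
    P y = ⌊ edgeOf y Fin.≟ e ⌋ ∧ Q y ∧ not (Q (cross y))
    found : any P (allFin n) ≡ true → Q a xor Q (cross a) ≡ true
    found h = let y , _ , Py = any-∃ P (allFin n) h
                  y∈e , Qy∧¬Qcy = ∧-true⁻ {⌊ edgeOf y Fin.≟ e ⌋} Py
                  Qy , ¬Qcy = ∧-true⁻ {Q y} Qy∧¬Qcy
              in begin
      Q a xor Q (cross a)                          ≡⟨ Vecₚ.lookup∘tabulate _ e ⟨
      lookup (δ Q) e                               ≡⟨ cong (lookup (δ Q)) (⌊⌋-sound (edgeOf y Fin.≟ e) y∈e) ⟨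
      lookup (δ Q) (edgeOf y)                      ≡⟨ δ-lookup inv y ⟩
      Q y xor Q (cross y)                          ≡⟨ cong₂ _xor_ Qy (trans (sym (Bool.not-involutive (Q (cross y)))) (cong not ¬Qcy)) ⟩
      true                                         ∎
    witness : Q a xor Q (cross a) ≡ true → any P (allFin n) ≡ true
    witness h with Q a in Qa | Q (cross a) in Qca
    ... | true  | false = any-∈ P (∈-allFin a)
                            (∧-true⁺ (⌊⌋-complete (edgeOf a Fin.≟ e) (edgeOf-flagOf e)) (∧-true⁺ Qa (cong not Qca)))
    ... | false | true  = any-∈ P (∈-allFin (cross a))
                            (∧-true⁺ (⌊⌋-complete (edgeOf (cross a) Fin.≟ e) (trans (edgeOf-cross a) (edgeOf-flagOf e)))
                                     (∧-true⁺ Qca (cong not (trans (cong Q (cross-involutive a)) Qa))))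

module OrbitSpan {n m} (generators : List (Fin n → Fin n)) (involutive : ∀ {g} → g ∈ generators → ∀ x → g (g x) ≡ x)
  (D : (Fin n → Bool) → Vect m)
  (D-cong : ∀ {f g} → (∀ x → f x ≡ g x) → D f ≡ D g)
  (D-xor : ∀ f g → D (λ x → f x xor g x) ≡ D f ⊕ D g)
  where
  open Orbits generators involutive

  D-false : D (λ _ → false) ≡ zeroV
  D-false = trans (D-xor (λ _ → false) (λ _ → false)) (⊕-self _)

  Invariant-xor : ∀ {f g} → Invariant f → Invariant g → Invariant (λ x → f x xor g x)
  Invariant-xor f-inv g-inv g∈ x = cong₂ _xor_ (f-inv g∈ x) (g-inv g∈ x)

  orbitGens : List (Fin n) → List (Vect m)
  orbitGens = map (D ∘ sameOrbit generators)

  inSpan-orbitGens⇒invariant : ∀ ys {X} → inSpan (orbitGens ys) X ≡ true → ∃ λ f → Invariant f × D f ≡ X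
  inSpan-orbitGens⇒invariant []       {X} X∈ = (λ _ → false) , (λ _ _ → refl) , trans D-false (sym (==V-sound (trans (sym (inSpan-[] X)) X∈)))
  inSpan-orbitGens⇒invariant (y ∷ ys) {X} X∈ with inSpan-∷⁻ (D (sameOrbit generators y)) (orbitGens ys) X∈
  ... | inj₁ X∈ys  = inSpan-orbitGens⇒invariant ys X∈ys
  ... | inj₂ OX∈ys = let f , f-inv , Df≡OX = inSpan-orbitGens⇒invariant ys OX∈ys in
    (λ x → sameOrbit generators y x xor f x) , Invariant-xor (sameOrbit-invariant y) f-inv , (begin
      D (λ x → sameOrbit generators y x xor f x)                      ≡⟨ D-xor (sameOrbit generators y) f ⟩
      D (sameOrbit generators y) ⊕ D f                                ≡⟨ cong (D (sameOrbit generators y) ⊕_) Df≡OX ⟩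
      D (sameOrbit generators y) ⊕ (D (sameOrbit generators y) ⊕ X)  ≡⟨ ⊕-cancelˡ (D (sameOrbit generators y)) X ⟩
      X                                                               ∎)

  -- If f is 1 at the first representative, subtract the indicator of its orbit and continue with the rest.
  covered⇒inSpan-orbitGens : ∀ ys {f} → Invariant f → (∀ x → f x ≡ true → Any (λ y → sameOrbit generators y x ≡ true) ys) →
    inSpan (orbitGens ys) (D f) ≡ true
  covered⇒inSpan-orbitGens [] {f} _ covered =
    subst (λ v → inSpan [] v ≡ true) (trans (sym D-false) (D-cong vanishes)) (inSpan-zero [])
    where
    vanishes : ∀ x → false ≡ f x
    vanishes x with f x in fx
    ... | false = refl
    ... | true  = case covered x fx of λ ()
  covered⇒inSpan-orbitGens (y ∷ ys) {f} f-inv covered with f y in fy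
  ... | false = inSpan-∷⁺ˡ (D (sameOrbit generators y)) (orbitGens ys) (covered⇒inSpan-orbitGens ys f-inv covered′)
    where
    covered′ : ∀ x → f x ≡ true → Any (λ y → sameOrbit generators y x ≡ true) ys
    covered′ x fx with covered x fx
    ... | here  yx  = case trans (sym fy) (trans (invariant-on-orbit f-inv yx) fx) of λ ()
    ... | there ysx = ysx
  ... | true = inSpan-∷⁺ʳ (D (sameOrbit generators y)) (orbitGens ys)
      (subst (λ v → inSpan (orbitGens ys) v ≡ true) (D-xor (sameOrbit generators y) f)
        (covered⇒inSpan-orbitGens ys (Invariant-xor (sameOrbit-invariant y) f-inv) covered′))
    where
    covered′ : ∀ x → sameOrbit generators y x xor f x ≡ true → Any (λ y → sameOrbit generators y x ≡ true) ys
    covered′ x h with sameOrbit generators y x in yx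
    ... | true  = case trans (sym (cong not (trans (sym (invariant-on-orbit f-inv yx)) fy))) h of λ ()
    ... | false with covered x h
    ...   | here  yx′ = case trans (sym yx) yx′ of λ ()
    ...   | there ysx = ysx

  invariant⇒inSpan-orbitGens : ∀ {f} → Invariant f → inSpan (orbitGens (allFin n)) (D f) ≡ true
  invariant⇒inSpan-orbitGens f-inv =
    covered⇒inSpan-orbitGens (allFin n) f-inv λ x _ → lose (∈-allFin x) (sameOrbit-refl x)

module CellSpace {n m} (M : Map n m) (C : Crossing M) (generators : List (Fin n → Fin n))
  (generator-cases : ∀ {g} → g ∈ generators → g ≡ Crossing.stay C ⊎ g ≡ Map.τ₁ M)
  (stay∈ : Crossing.stay C ∈ generators) (τ₁∈ : Map.τ₁ M ∈ generators)
  where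
  open Map M using (τ₁; τ₁-inv; edgeOf)
  open Crossing C
  open EdgeDifference C public

  involutive : ∀ {g} → g ∈ generators → ∀ x → g (g x) ≡ x
  involutive g∈ with generator-cases g∈
  ... | inj₁ refl = stay-involutive
  ... | inj₂ refl = τ₁-inv

  open Orbits generators involutive public
  open OrbitSpan generators involutive δ δ-cong δ-xor public

  orbit-stayInvariant : ∀ x → StayInvariant (sameOrbit generators x)
  orbit-stayInvariant x = sameOrbit-invariant x stay∈

  Colouring : Vect m → (Fin n → Bool) → Set
  Colouring X f = (∀ x → f (τ₁ x) ≡ f x) × StayInvariant f × (∀ x → f (cross x) ≡ f x xor lookup X (edgeOf x))

  inSpan⇒colouring : ∀ {X} → inSpan (orbitGens (allFin n)) X ≡ true → ∃ (Colouring X)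
  inSpan⇒colouring X∈ = let f , f-inv , δf≡X = inSpan-orbitGens⇒invariant (allFin n) X∈ in
    f , f-inv τ₁∈ , f-inv stay∈ , δ≡⇒cross-rule (f-inv stay∈) δf≡X

  colouring⇒inSpan : ∀ {X f} → Colouring X f → inSpan (orbitGens (allFin n)) X ≡ true
  colouring⇒inSpan {X} {f} (τ₁-inv-f , stay-inv-f , rule) =
    subst (λ v → inSpan (orbitGens (allFin n)) v ≡ true) (cross-rule⇒δ≡ {f} rule) (invariant⇒inSpan-orbitGens f-inv)
    where
    f-inv : Invariant f
    f-inv g∈ with generator-cases g∈
    ... | inj₁ refl = stay-inv-f
    ... | inj₂ refl = τ₁-inv-f

-- Vertices, faces and zigzags

module MapSpaces {n m} (M : Map n m) where
  open Map M

  vertexCrossing : Crossing M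
  vertexCrossing = record
    { cross = τ₀ ; stay = τ₂
    ; cross-involutive = τ₀-inv ; stay-involutive = τ₂-inv
    ; cross-stay-comm = τ₀τ₂-comm
    ; cross-fpf = τ₀-fpf ; stay-fpf = τ₂-fpf ; cross-stay-fpf = τ₀τ₂-fpf
    ; edgeOf-cross = edgeOf-τ₀ ; edgeOf-stay = edgeOf-τ₂
    ; edge-flags = edgeOf-same
    }

  faceCrossing : Crossing M
  faceCrossing = record
    { cross = τ₂ ; stay = τ₀
    ; cross-involutive = τ₂-inv ; stay-involutive = τ₀-inv
    ; cross-stay-comm = λ x → sym (τ₀τ₂-comm x)
    ; cross-fpf = τ₂-fpf ; stay-fpf = τ₀-fpf ; cross-stay-fpf = λ x h → τ₀τ₂-fpf x (trans (τ₀τ₂-comm x) h)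
    ; edgeOf-cross = edgeOf-τ₂ ; edgeOf-stay = edgeOf-τ₀
    ; edge-flags = λ x y same → case edgeOf-same x y same of λ where
        (inj₁ y≡x)                 → inj₁ y≡x
        (inj₂ (inj₁ y≡τ₀x))        → inj₂ (inj₂ (inj₁ y≡τ₀x))
        (inj₂ (inj₂ (inj₁ y≡τ₂x))) → inj₂ (inj₁ y≡τ₂x)
        (inj₂ (inj₂ (inj₂ y≡)))    → inj₂ (inj₂ (inj₂ (trans y≡ (τ₀τ₂-comm x))))
    }

  τ₀τ₂-involutive : ∀ x → τ₀ (τ₂ (τ₀ (τ₂ x))) ≡ x
  τ₀τ₂-involutive x = begin
    τ₀ (τ₂ (τ₀ (τ₂ x)))  ≡⟨ cong τ₀ (τ₀τ₂-comm (τ₂ x)) ⟨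
    τ₀ (τ₀ (τ₂ (τ₂ x)))  ≡⟨ τ₀-inv (τ₂ (τ₂ x)) ⟩
    τ₂ (τ₂ x)            ≡⟨ τ₂-inv x ⟩
    x                    ∎

  zigzagCrossing : Crossing M
  zigzagCrossing = record
    { cross = τ₀ ; stay = τ₀ ∘ τ₂
    ; cross-involutive = τ₀-inv ; stay-involutive = τ₀τ₂-involutive
    ; cross-stay-comm = λ x → cong τ₀ (τ₀τ₂-comm x)
    ; cross-fpf = τ₀-fpf ; stay-fpf = τ₀τ₂-fpf ; cross-stay-fpf = λ x h → τ₂-fpf x (trans (sym (τ₀-inv (τ₂ x))) h)
    ; edgeOf-cross = edgeOf-τ₀ ; edgeOf-stay = λ x → trans (edgeOf-τ₀ (τ₂ x)) (edgeOf-τ₂ x)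
    ; edge-flags = λ x y same → case edgeOf-same x y same of λ where
        (inj₁ y≡x)                 → inj₁ y≡x
        (inj₂ (inj₁ y≡τ₀x))        → inj₂ (inj₁ y≡τ₀x)
        (inj₂ (inj₂ (inj₁ y≡τ₂x))) → inj₂ (inj₂ (inj₂ (trans y≡τ₂x (sym (τ₀-inv (τ₂ x))))))
        (inj₂ (inj₂ (inj₂ y≡)))    → inj₂ (inj₂ (inj₁ y≡))
    }

  vertexGens-cases : ∀ {g} → g ∈ vertexGens M → g ≡ τ₂ ⊎ g ≡ τ₁
  vertexGens-cases (here refl)         = inj₂ refl
  vertexGens-cases (there (here refl)) = inj₁ refl

  faceGens-cases : ∀ {g} → g ∈ faceGens M → g ≡ τ₀ ⊎ g ≡ τ₁
  faceGens-cases (here refl)         = inj₁ refl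
  faceGens-cases (there (here refl)) = inj₂ refl

  zigzagGens-cases : ∀ {g} → g ∈ zigzagGens M → g ≡ τ₀ ∘ τ₂ ⊎ g ≡ τ₁
  zigzagGens-cases (here refl)         = inj₁ refl
  zigzagGens-cases (there (here refl)) = inj₂ refl

  module V = CellSpace M vertexCrossing (vertexGens M) vertexGens-cases (there (here refl)) (here refl)
  module F = CellSpace M faceCrossing (faceGens M) faceGens-cases (here refl) (there (here refl))
  module Z = CellSpace M zigzagCrossing (zigzagGens M) zigzagGens-cases (here refl) (there (here refl))

  𝒱₁ 𝒱₂ 𝒱₃ : List (Vect m)
  𝒱₁ = gens M zero
  𝒱₂ = gens M (suc zero)
  𝒱₃ = gens M (suc (suc zero))

  𝒱₁≡orbitGens : 𝒱₁ ≡ V.orbitGens (allFin n)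
  𝒱₁≡orbitGens = Listₚ.map-cong (λ x → Vecₚ.tabulate-cong (V.any-boundary-flag (V.orbit-stayInvariant x))) (allFin n)

  𝒱₂≡orbitGens : 𝒱₂ ≡ F.orbitGens (allFin n)
  𝒱₂≡orbitGens = Listₚ.map-cong (λ x → Vecₚ.tabulate-cong (F.traversal-parity (F.orbit-stayInvariant x))) (allFin n)

  𝒱₃≡orbitGens : 𝒱₃ ≡ Z.orbitGens (allFin n)
  𝒱₃≡orbitGens = Listₚ.map-cong (λ x → Vecₚ.tabulate-cong (Z.traversal-parity (Z.orbit-stayInvariant x))) (allFin n)

  -- A τ₁-invariant colouring of the flags that changes across τ₀ (resp. τ₂) exactly on the edges of X if p₀
  -- (resp. p₂) holds and never otherwise; 𝒱₁, 𝒱₂, 𝒱₃ are the X admitting one of type (1,0), (0,1), (1,1).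
  record Potential (p₀ p₂ : Bool) (X : Vect m) (f : Fin n → Bool) : Set where
    constructor potential
    field
      across-τ₁ : ∀ x → f (τ₁ x) ≡ f x
      across-τ₀ : ∀ x → f (τ₀ x) ≡ f x xor (p₀ ∧ lookup X (edgeOf x))
      across-τ₂ : ∀ x → f (τ₂ x) ≡ f x xor (p₂ ∧ lookup X (edgeOf x))

  potential-xor : ∀ {p₀ p₂ q₀ q₂ X f g} → Potential p₀ p₂ X f → Potential q₀ q₂ X g →
    Potential (p₀ xor q₀) (p₂ xor q₂) X (λ x → f x xor g x)
  potential-xor {p₀} {p₂} {q₀} {q₂} {X} {f} {g} (potential f₁ f₀ f₂) (potential g₁ g₀ g₂) =
    potential (λ x → cong₂ _xor_ (f₁ x) (g₁ x)) (across p₀ q₀ τ₀ f₀ g₀) (across p₂ q₂ τ₂ f₂ g₂)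
    where
    across : ∀ p q (τ : Fin n → Fin n) →
      (∀ x → f (τ x) ≡ f x xor (p ∧ lookup X (edgeOf x))) → (∀ x → g (τ x) ≡ g x xor (q ∧ lookup X (edgeOf x))) →
      ∀ x → f (τ x) xor g (τ x) ≡ (f x xor g x) xor ((p xor q) ∧ lookup X (edgeOf x))
    across p q τ fτ gτ x = begin
      f (τ x) xor g (τ x)                                       ≡⟨ cong₂ _xor_ (fτ x) (gτ x) ⟩
      (f x xor (p ∧ Xx)) xor (g x xor (q ∧ Xx))                 ≡⟨ xor-Properties.interchange (f x) (p ∧ Xx) (g x) (q ∧ Xx) ⟩
      (f x xor g x) xor ((p ∧ Xx) xor (q ∧ Xx))                 ≡⟨ cong ((f x xor g x) xor_) (Bool.∧-distribʳ-xor Xx p q) ⟨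
      (f x xor g x) xor ((p xor q) ∧ Xx)                        ∎
      where Xx = lookup X (edgeOf x)

  𝒱₁⇒potential : ∀ {X} → inSpan 𝒱₁ X ≡ true → ∃ (Potential true false X)
  𝒱₁⇒potential {X} X∈ =
    let f , f₁ , f₂ , f₀ = V.inSpan⇒colouring (subst (λ L → inSpan L X ≡ true) 𝒱₁≡orbitGens X∈)
    in f , potential f₁ f₀ λ x → trans (f₂ x) (sym (Bool.xor-identityʳ (f x)))

  potential⇒𝒱₁ : ∀ {X f} → Potential true false X f → inSpan 𝒱₁ X ≡ true
  potential⇒𝒱₁ {X} {f} (potential f₁ f₀ f₂) = subst (λ L → inSpan L X ≡ true) (sym 𝒱₁≡orbitGens)
    (V.colouring⇒inSpan {X} {f} (f₁ , (λ x → trans (f₂ x) (Bool.xor-identityʳ (f x))) , f₀))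

  𝒱₂⇒potential : ∀ {X} → inSpan 𝒱₂ X ≡ true → ∃ (Potential false true X)
  𝒱₂⇒potential {X} X∈ =
    let f , f₁ , f₀ , f₂ = F.inSpan⇒colouring (subst (λ L → inSpan L X ≡ true) 𝒱₂≡orbitGens X∈)
    in f , potential f₁ (λ x → trans (f₀ x) (sym (Bool.xor-identityʳ (f x)))) f₂

  potential⇒𝒱₂ : ∀ {X f} → Potential false true X f → inSpan 𝒱₂ X ≡ true
  potential⇒𝒱₂ {X} {f} (potential f₁ f₀ f₂) = subst (λ L → inSpan L X ≡ true) (sym 𝒱₂≡orbitGens)
    (F.colouring⇒inSpan {X} {f} (f₁ , (λ x → trans (f₀ x) (Bool.xor-identityʳ (f x))) , f₂))

  𝒱₃⇒potential : ∀ {X} → inSpan 𝒱₃ X ≡ true → ∃ (Potential true true X)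
  𝒱₃⇒potential {X} X∈ =
    let f , f₁ , f₀₂ , f₀ = Z.inSpan⇒colouring (subst (λ L → inSpan L X ≡ true) 𝒱₃≡orbitGens X∈)
        f₂ : ∀ x → f (τ₂ x) ≡ f x xor lookup X (edgeOf x)
        f₂ x = begin
          f (τ₂ x)                                           ≡⟨ cong f (τ₀-inv (τ₂ x)) ⟨
          f (τ₀ (τ₀ (τ₂ x)))                                 ≡⟨ f₀ (τ₀ (τ₂ x)) ⟩
          f (τ₀ (τ₂ x)) xor lookup X (edgeOf (τ₀ (τ₂ x)))    ≡⟨ cong₂ (λ b e → b xor lookup X e) (f₀₂ x) (Crossing.edgeOf-stay zigzagCrossing x) ⟩
          f x xor lookup X (edgeOf x)                        ∎
    in f , potential f₁ f₀ f₂

  potential⇒𝒱₃ : ∀ {X f} → Potential true true X f → inSpan 𝒱₃ X ≡ true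
  potential⇒𝒱₃ {X} {f} (potential f₁ f₀ f₂) = subst (λ L → inSpan L X ≡ true) (sym 𝒱₃≡orbitGens)
    (Z.colouring⇒inSpan {X} {f} (f₁ , f₀₂ , f₀))
    where
    f₀₂ : ∀ x → f (τ₀ (τ₂ x)) ≡ f x
    f₀₂ x = begin
      f (τ₀ (τ₂ x))                                            ≡⟨ f₀ (τ₂ x) ⟩
      f (τ₂ x) xor lookup X (edgeOf (τ₂ x))                    ≡⟨ cong₂ (λ b e → b xor lookup X e) (f₂ x) (edgeOf-τ₂ x) ⟩
      (f x xor lookup X (edgeOf x)) xor lookup X (edgeOf x)    ≡⟨ xor-cancelʳ (f x) (lookup X (edgeOf x)) ⟩
      f x                                                      ∎

  𝒱₁∩𝒱₂⊆𝒱₃ : ∀ {X} → inSpan 𝒱₁ X ≡ true → inSpan 𝒱₂ X ≡ true → inSpan 𝒱₃ X ≡ true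
  𝒱₁∩𝒱₂⊆𝒱₃ X∈₁ X∈₂ = potential⇒𝒱₃ (potential-xor (proj₂ (𝒱₁⇒potential X∈₁)) (proj₂ (𝒱₂⇒potential X∈₂)))

  𝒱₁∩𝒱₃⊆𝒱₂ : ∀ {X} → inSpan 𝒱₁ X ≡ true → inSpan 𝒱₃ X ≡ true → inSpan 𝒱₂ X ≡ true
  𝒱₁∩𝒱₃⊆𝒱₂ X∈₁ X∈₃ = potential⇒𝒱₂ (potential-xor (proj₂ (𝒱₁⇒potential X∈₁)) (proj₂ (𝒱₃⇒potential X∈₃)))

  𝒱₂∩𝒱₃⊆𝒱₁ : ∀ {X} → inSpan 𝒱₂ X ≡ true → inSpan 𝒱₃ X ≡ true → inSpan 𝒱₁ X ≡ true
  𝒱₂∩𝒱₃⊆𝒱₁ X∈₂ X∈₃ = potential⇒𝒱₁ (potential-xor (proj₂ (𝒱₂⇒potential X∈₂)) (proj₂ (𝒱₃⇒potential X∈₃)))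

  ∩₂₃≡∩₁₃ : ∀ v → inSpan 𝒱₂ v ∧ inSpan 𝒱₃ v ≡ inSpan 𝒱₁ v ∧ inSpan 𝒱₃ v
  ∩₂₃≡∩₁₃ v = bool-ext
    (λ h → let v∈₂ , v∈₃ = ∧-true⁻ {inSpan 𝒱₂ v} h in ∧-true⁺ (𝒱₂∩𝒱₃⊆𝒱₁ v∈₂ v∈₃) v∈₃)
    (λ h → let v∈₁ , v∈₃ = ∧-true⁻ {inSpan 𝒱₁ v} h in ∧-true⁺ (𝒱₁∩𝒱₃⊆𝒱₂ v∈₁ v∈₃) v∈₃)

  ∩₁₃≡∩₁₂ : ∀ v → inSpan 𝒱₁ v ∧ inSpan 𝒱₃ v ≡ inSpan 𝒱₁ v ∧ inSpan 𝒱₂ v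
  ∩₁₃≡∩₁₂ v = bool-ext
    (λ h → let v∈₁ , v∈₃ = ∧-true⁻ {inSpan 𝒱₁ v} h in ∧-true⁺ v∈₁ (𝒱₁∩𝒱₃⊆𝒱₂ v∈₁ v∈₃))
    (λ h → let v∈₁ , v∈₂ = ∧-true⁻ {inSpan 𝒱₁ v} h in ∧-true⁺ v∈₁ (𝒱₁∩𝒱₂⊆𝒱₃ v∈₁ v∈₂))

mainTheorem1 : ∀ {n m : ℕ} (M : Map n m) →
    (cdef M zero (suc zero) (suc (suc zero)) ≡ cdef M (suc zero) zero (suc (suc zero)))
    × (cdef M (suc zero) zero (suc (suc zero)) ≡ cdef M (suc (suc zero)) zero (suc zero))
mainTheorem1 {m = m} M = cdef₁≡cdef₂ , cdef₂≡cdef₃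
  where
  open MapSpaces M using (𝒱₁; 𝒱₂; 𝒱₃; ∩₂₃≡∩₁₃; ∩₁₃≡∩₁₂)
  d₁ = dim (inSpan 𝒱₁)
  d₂ = dim (inSpan 𝒱₂)
  d₃ = dim (inSpan 𝒱₃)

  cdef₁≡cdef₂ : cdef M zero (suc zero) (suc (suc zero)) ≡ cdef M (suc zero) zero (suc (suc zero))
  cdef₁≡cdef₂ = begin
    cdef M zero (suc zero) (suc (suc zero))                              ≡⟨ cdef-formula 𝒱₁ 𝒱₂ 𝒱₃ ⟩
    (m + dim (λ v → inSpan 𝒱₂ v ∧ inSpan 𝒱₃ v)) ∸ (d₁ + (d₂ + d₃))
      ≡⟨ cong₂ _∸_ (cong (m +_) (dim-cong ∩₂₃≡∩₁₃)) (ℕ-+.x∙yz≈y∙xz d₁ d₂ d₃) ⟩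
    (m + dim (λ v → inSpan 𝒱₁ v ∧ inSpan 𝒱₃ v)) ∸ (d₂ + (d₁ + d₃))    ≡⟨ cdef-formula 𝒱₂ 𝒱₁ 𝒱₃ ⟨
    cdef M (suc zero) zero (suc (suc zero))                              ∎

  cdef₂≡cdef₃ : cdef M (suc zero) zero (suc (suc zero)) ≡ cdef M (suc (suc zero)) zero (suc zero)
  cdef₂≡cdef₃ = begin
    cdef M (suc zero) zero (suc (suc zero))                              ≡⟨ cdef-formula 𝒱₂ 𝒱₁ 𝒱₃ ⟩
    (m + dim (λ v → inSpan 𝒱₁ v ∧ inSpan 𝒱₃ v)) ∸ (d₂ + (d₁ + d₃))
      ≡⟨ cong₂ _∸_ (cong (m +_) (dim-cong ∩₁₃≡∩₁₂)) (ℕ-+.x∙yz≈z∙yx d₂ d₁ d₃) ⟩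
    (m + dim (λ v → inSpan 𝒱₁ v ∧ inSpan 𝒱₂ v)) ∸ (d₃ + (d₁ + d₂))    ≡⟨ cdef-formula 𝒱₃ 𝒱₁ 𝒱₂ ⟨
    cdef M (suc (suc zero)) zero (suc zero)                              ∎
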